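{- Let $k \geq 4$ be a fixed even integer. Then the following two implications hold. (i) For every $\varepsilon > 0$ there exist $\delta > 0$ and $n_0$ such that every tournament $T$ on $n \geq n_0$ vertices satisfying $$\sum_{v \in X} \left| d^+(v,Y) - d^-(v,Y) \right| \leq \delta n^2 \quad \text{for all } X, Y \subseteq V(T)$$ satisfies $\left| \mathrm{ec}_k(T) - \tfrac12 n^k \right| \leq \varepsilon n^k$. (ii) For every $\varepsilon > 0$ there exist $\delta > 0$ and $n_0$ such that every tournament $T$ on $n \geq n_0$ vertices satisfying $\left| \mathrm{ec}_k(T) - \tfrac12 n^k \right| \leq \delta n^k$ satisfies $$\sum_{v \in X} \left| d^+(v,Y) - d^-(v,Y) \right| \leq \varepsilon n^2 \quad \text{for all } X, Y \subseteq V(T).$$ In other words, a tournament satisfies property $\mathcal{Q}$ if and only if it satisfies property $\mathcal{P}(k)$.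
   Context: A tournament $T=(V,E)$ on $n=|V|$ vertices is a directed graph such that for any two distinct vertices $u,v$ exactly one of the directed edges $(u,v)$, $(v,u)$ is in $E$ (and there are no loops). For $Y \subseteq V$ and $v \in V$, $d^+(v,Y)$ is the number of edges $(v,y)\in E$ with $y \in Y$, and $d^-(v,Y)$ is the number of edges $(y,v)\in E$ with $y \in Y$. A $k$-cycle is an ordered sequence of vertices $(v_1, v_2, \ldots, v_k, v_1)$ (vertices may repeat) such that $v_i \neq v_{i+1}$ for all $i \leq k-1$ and $v_k \neq v_1$. A $k$-cycle is even if the number of indices $i \in \{1,\dots,k\}$ for which the edge between $v_i$ and $v_{i+1}$ (indices mod $k$, so $v_{k+1}=v_1$) is directed from $v_{i+1}$ to $v_i$ is even; otherwise it is odd. $\mathrm{ec}_k(T)$ denotes the number of even $k$-cycles in $T$. Property $\mathcal{Q}$ means $\sum_{v\in X}|d^+(v,Y)-d^-(v,Y)| = o(n^2)$ for all $X,Y\subseteq V$; property $\mathcal{P}(k)$ means $\mathrm{ec}_k(T) = (1/2 \pm o(1)) n^k$.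
   Formalization: The parameter ε ranges over the positive rationals, and the corresponding δ is taken in the positive rationals as well. -}

module Defs where

open import Data.Bool using (Bool; true; false; not; _∧_; if_then_else_)
open import Data.Nat using (ℕ; zero; suc; _+_; _*_; _^_; _%_; _≡ᵇ_; ∣_-_∣)
open import Data.Fin using (Fin)
open import Data.Fin.Properties using (_≟_)
open import Data.List using (List; []; _∷_; [_]; _++_; map; concatMap; filterᵇ; length; zip; allFin)
open import Data.Nat.ListAction using (sum)
open import Data.Product using (_×_; _,_)
open import Data.Vec using (Vec; lookup)
open import Data.Integer using (+_)
open import Data.Rational using (ℚ; _/_)
open import Relation.Nullary using (does)
open import Relation.Binary.PropositionalEquality using (_≡_; _≢_)

record Tournament (n : ℕ) : Set where
  field
    adj       : Fin n → Fin n → Bool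
    loopless  : ∀ u → adj u u ≡ false
    tournament : ∀ u v → u ≢ v → adj v u ≡ not (adj u v)
open Tournament public

Subset : ℕ → Set
Subset n = Vec Bool n

outdeg : ∀ {n} → Tournament n → Fin n → Subset n → ℕ
outdeg {n} T v Y = length (filterᵇ (λ y → lookup Y y ∧ adj T v y) (allFin n))

indeg : ∀ {n} → Tournament n → Fin n → Subset n → ℕ
indeg {n} T v Y = length (filterᵇ (λ y → lookup Y y ∧ adj T y v) (allFin n))

discrepancy : ∀ {n} → Tournament n → Subset n → Subset n → ℕ
discrepancy {n} T X Y =
  sum (map (λ v → if lookup X v then ∣ outdeg T v Y - indeg T v Y ∣ else 0) (allFin n))

tuples : (n k : ℕ) → List (List (Fin n))
tuples n zero = [ [] ]
tuples n (suc k) = concatMap (λ x → map (x ∷_) (tuples n k)) (allFin n)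

cyclePairs : ∀ {n} → List (Fin n) → List (Fin n × Fin n)
cyclePairs [] = []
cyclePairs (x ∷ xs) = zip (x ∷ xs) (xs ++ [ x ])

allb : ∀ {A : Set} → (A → Bool) → List A → Bool
allb p [] = true
allb p (x ∷ xs) = p x ∧ allb p xs

isCycle : ∀ {n} → List (Fin n) → Bool
isCycle c = allb (λ { (a , b) → not (does (a ≟ b)) }) (cyclePairs c)

backward : ∀ {n} → Tournament n → List (Fin n) → ℕ
backward T c = length (filterᵇ (λ { (a , b) → adj T b a }) (cyclePairs c))

isEvenCycle : ∀ {n} → Tournament n → List (Fin n) → Bool
isEvenCycle T c = isCycle c ∧ (backward T c % 2 ≡ᵇ 0)

ec : ∀ {n} → ℕ → Tournament n → ℕ
ec {n} k T = length (filterᵇ (isEvenCycle T) (tuples n k))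

ℕtoℚ : ℕ → ℚ
ℕtoℚ m = (+ m) / 1

-- Let S be the skew-adjacency matrix of T (S u v = ±1 by the direction of uv,
-- 0 on the diagonal) and A = J - I.  Along a closed walk the product of
-- A-entries is 1 iff the walk is a k-cycle, and the product of S-entries is
-- then (-1)^(backward edges); so 2 ec_k(T) = tr A^k + tr S^k, while
-- n^k - 2k n^(k-1) ≤ tr A^k ≤ n^k.  Hence |2 ec_k - n^k| is |tr S^k| up to O(k n^(k-1)).
--  (i)  tr S^k = Σ_{z,w} (S^(k-3))_{zw} (S³)_{wz} and every entry of S³ is
--       bounded by two discrepancies, so Q forces |tr S^k| ≤ 2δ n^k.
--  (ii) For k = 2m and y = 1_Y, disc(X,Y) ≤ Σ_x |(S y)_x|; skewness and
--       Cauchy–Schwarz make a_j = ‖S^j y‖² log-convex, which yields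
--       disc(X,Y)^(2m) ≤ n^(2m) ‖S^m‖_F² = n^(2m) |tr S^k|.
module Submission where

open import Defs

module Core where

  open import Data.Nat as ℕ using (ℕ; zero; suc; _%_; _≡ᵇ_; _^_)
  import Data.Nat.Properties as ℕP
  import Data.Nat.Tactic.RingSolver as ℕSolver
  open import Data.Nat.DivMod using ([m+n]%n≡m%n)
  open import Data.Nat.ListAction using (sum)
  open import Data.Integer as ℤ
    using (ℤ; +_; 0ℤ; 1ℤ; -1ℤ; _+_; _*_; -_; _-_; _≤_; ∣_∣; +≤+; _⊖_)
    renaming (_^_ to _^ᶻ_)
  import Data.Integer.Properties as ℤP
  open import Data.Integer.Tactic.RingSolver using (solve-∀)
  open import Data.Fin using (Fin; zero; suc)
  open import Data.Fin.Properties using (_≟_)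
  open import Data.List using (List; []; _∷_; [_]; map; concatMap; length; filterᵇ; _++_; zip; allFin; tabulate)
  open import Data.List.Properties using (length-tabulate)
  open import Data.Vec using (lookup; replicate)
  import Data.Vec as Vec
  open import Data.Vec.Properties using (lookup∘tabulate; lookup-replicate)
  open import Data.Bool using (Bool; true; false; if_then_else_; not; _∧_)
  open import Data.Product using (_×_; _,_; proj₁; proj₂)
  open import Data.Empty using (⊥-elim)
  open import Relation.Nullary using (does; yes; no)
  open import Relation.Binary.PropositionalEquality hiding ([_])

  sumL : {A : Set} → List A → (A → ℤ) → ℤ
  sumL [] f = 0ℤ
  sumL (x ∷ xs) f = f x + sumL xs f

  Σ : ∀ {n} → (Fin n → ℤ) → ℤ
  Σ {n} f = sumL (allFin n) f

  abs : ℤ → ℤ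
  abs z = + ∣ z ∣

  module _ {A : Set} where
    sum-cong : (L : List A) {f g : A → ℤ} → (∀ x → f x ≡ g x) → sumL L f ≡ sumL L g
    sum-cong [] e = refl
    sum-cong (x ∷ L) e = cong₂ _+_ (e x) (sum-cong L e)

    sum-+ : (L : List A) (f g : A → ℤ) → sumL L (λ x → f x + g x) ≡ sumL L f + sumL L g
    sum-+ [] f g = refl
    sum-+ (x ∷ L) f g rewrite sum-+ L f g = interchange (f x) (g x) (sumL L f) (sumL L g)
      where interchange : ∀ a b c d → (a + b) + (c + d) ≡ (a + c) + (b + d)
            interchange = solve-∀

    sum-*ˡ : (L : List A) (c : ℤ) (f : A → ℤ) → sumL L (λ x → c * f x) ≡ c * sumL L f
    sum-*ˡ [] c f = sym (ℤP.*-zeroʳ c)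
    sum-*ˡ (x ∷ L) c f rewrite sum-*ˡ L c f = sym (ℤP.*-distribˡ-+ c (f x) (sumL L f))

    sum-*ʳ : (L : List A) (c : ℤ) (f : A → ℤ) → sumL L (λ x → f x * c) ≡ sumL L f * c
    sum-*ʳ L c f = trans (sum-cong L (λ x → ℤP.*-comm (f x) c)) (trans (sum-*ˡ L c f) (ℤP.*-comm c _))

    sum-neg : (L : List A) (f : A → ℤ) → sumL L (λ x → - f x) ≡ - sumL L f
    sum-neg [] f = refl
    sum-neg (x ∷ L) f rewrite sum-neg L f = sym (ℤP.neg-distrib-+ (f x) (sumL L f))

    sum-0 : (L : List A) → sumL L (λ _ → 0ℤ) ≡ 0ℤ
    sum-0 [] = refl
    sum-0 (x ∷ L) = trans (ℤP.+-identityˡ _) (sum-0 L)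

    sum-const : (L : List A) (c : ℤ) → sumL L (λ _ → c) ≡ + length L * c
    sum-const [] c = refl
    sum-const (x ∷ L) c rewrite sum-const L c = step c (+ length L)
      where step : ∀ c l → c + l * c ≡ (1ℤ + l) * c
            step = solve-∀

    sum-mono : (L : List A) {f g : A → ℤ} → (∀ x → f x ≤ g x) → sumL L f ≤ sumL L g
    sum-mono [] e = ℤP.≤-refl
    sum-mono (x ∷ L) e = ℤP.+-mono-≤ (e x) (sum-mono L e)

    sum-nonneg : (L : List A) {f : A → ℤ} → (∀ x → 0ℤ ≤ f x) → 0ℤ ≤ sumL L f
    sum-nonneg L {f} e = subst (_≤ sumL L f) (sum-0 L) (sum-mono L e)

    sum-abs : (L : List A) (f : A → ℤ) → abs (sumL L f) ≤ sumL L (λ x → abs (f x))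
    sum-abs [] f = ℤP.≤-refl
    sum-abs (x ∷ L) f = ℤP.≤-trans (+≤+ (ℤP.∣i+j∣≤∣i∣+∣j∣ (f x) (sumL L f)))
                                   (ℤP.+-monoʳ-≤ (abs (f x)) (sum-abs L f))

    sum-++ : (L M : List A) (f : A → ℤ) → sumL (L ++ M) f ≡ sumL L f + sumL M f
    sum-++ [] M f = sym (ℤP.+-identityˡ _)
    sum-++ (x ∷ L) M f rewrite sum-++ L M f = sym (ℤP.+-assoc (f x) _ _)

    sum-filter : (L : List A) (p : A → Bool) →
                 + length (filterᵇ p L) ≡ sumL L (λ x → if p x then 1ℤ else 0ℤ)
    sum-filter [] p = refl
    sum-filter (x ∷ L) p with p x
    ... | true = trans (ℤP.pos-+ 1 (length (filterᵇ p L))) (cong (_+_ (1ℤ)) (sum-filter L p))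
    ... | false = trans (sum-filter L p) (sym (ℤP.+-identityˡ _))

    sum-ℕ : (L : List A) (h : A → ℕ) → + sum (map h L) ≡ sumL L (λ x → + h x)
    sum-ℕ [] h = refl
    sum-ℕ (x ∷ L) h = trans (ℤP.pos-+ (h x) (sum (map h L))) (cong (_+_ (+ h x)) (sum-ℕ L h))

  module _ {A B : Set} where
    sum-map : (L : List A) (h : A → B) (f : B → ℤ) → sumL (map h L) f ≡ sumL L (λ x → f (h x))
    sum-map [] h f = refl
    sum-map (x ∷ L) h f = cong (_+_ (f (h x))) (sum-map L h f)

    sum-concatMap : (L : List A) (g : A → List B) (f : B → ℤ) →
                    sumL (concatMap g L) f ≡ sumL L (λ x → sumL (g x) f)
    sum-concatMap [] g f = refl
    sum-concatMap (x ∷ L) g f =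
      trans (sum-++ (g x) (concatMap g L) f) (cong (_+_ (sumL (g x) f)) (sum-concatMap L g f))

    sum-swap : (L : List A) (M : List B) (f : A → B → ℤ) →
      sumL L (λ x → sumL M (λ y → f x y)) ≡ sumL M (λ y → sumL L (λ x → f x y))
    sum-swap [] M f = sym (sum-0 M)
    sum-swap (x ∷ L) M f rewrite sum-swap L M f = sym (sum-+ M (f x) (λ y → sumL L (λ x → f x y)))

  Σ-*ˡ : ∀ {n} c (f : Fin n → ℤ) → c * Σ {n} f ≡ Σ {n} (λ x → c * f x)
  Σ-*ˡ {n} c f = sym (sum-*ˡ (allFin n) c f)

  Σ-tabulate : ∀ {n} {A : Set} (g : Fin n → A) (f : A → ℤ) → sumL (tabulate g) f ≡ Σ {n} (λ x → f (g x))
  Σ-tabulate {zero} g f = refl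
  Σ-tabulate {suc n} g f =
    cong (_+_ (f (g zero))) (trans (Σ-tabulate (λ x → g (suc x)) f) (sym (Σ-tabulate suc (λ x → f (g x)))))

  Σ-suc : ∀ {n} (f : Fin (suc n) → ℤ) → Σ {suc n} f ≡ f zero + Σ {n} (λ x → f (suc x))
  Σ-suc {n} f = cong (_+_ (f zero)) (Σ-tabulate suc f)

  Σ-const : ∀ {n} c → Σ {n} (λ _ → c) ≡ + n * c
  Σ-const {n} c = trans (sum-const (allFin n) c) (cong (λ l → + l * c) (length-tabulate {n = n} (λ x → x)))

  Σ-const-ℕ : ∀ {n} c → Σ {n} (λ _ → + c) ≡ + (n ℕ.* c)
  Σ-const-ℕ {n} c = trans (Σ-const {n} (+ c)) (sym (ℤP.pos-* n c))

  ≤-by-difference : ∀ {a b} d → 0ℤ ≤ d → b ≡ a + d → a ≤ b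
  ≤-by-difference {a} d 0≤d refl =
    ℤP.≤-trans (ℤP.≤-reflexive (sym (ℤP.+-identityʳ a))) (ℤP.+-monoʳ-≤ a 0≤d)

  0≤+ : ∀ {m} → 0ℤ ≤ + m
  0≤+ = +≤+ ℕ.z≤n

  0≤* : ∀ {a b} → 0ℤ ≤ a → 0ℤ ≤ b → 0ℤ ≤ a * b
  0≤* {+ x} {+ y} _ _ = subst (0ℤ ≤_) (ℤP.pos-* x y) 0≤+

  0≤square : ∀ a → 0ℤ ≤ a * a
  0≤square (+ x) = 0≤* {+ x} {+ x} 0≤+ 0≤+
  0≤square ℤ.-[1+ x ] = 0≤+

  0≤^ : ∀ {a} m → 0ℤ ≤ a → 0ℤ ≤ a ^ᶻ m
  0≤^ zero _ = 0≤+
  0≤^ (suc m) 0≤a = 0≤* 0≤a (0≤^ m 0≤a)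

  *-monoˡ : ∀ {c a b} → 0ℤ ≤ c → a ≤ b → c * a ≤ c * b
  *-monoˡ {+ x} _ a≤b = ℤP.*-monoˡ-≤-nonNeg (+ x) a≤b

  *-monoʳ : ∀ {c a b} → 0ℤ ≤ c → a ≤ b → a * c ≤ b * c
  *-monoʳ {+ x} _ a≤b = ℤP.*-monoʳ-≤-nonNeg (+ x) a≤b

  *-mono : ∀ {a b c d} → 0ℤ ≤ a → 0ℤ ≤ c → a ≤ b → c ≤ d → a * c ≤ b * d
  *-mono 0≤a 0≤c a≤b c≤d = ℤP.≤-trans (*-monoʳ 0≤c a≤b) (*-monoˡ (ℤP.≤-trans 0≤a a≤b) c≤d)

  abs-* : ∀ a b → abs (a * b) ≡ abs a * abs b
  abs-* a b = trans (cong +_ (ℤP.abs-* a b)) (ℤP.pos-* ∣ a ∣ ∣ b ∣)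

  abs-+ : ∀ a b → abs (a + b) ≤ abs a + abs b
  abs-+ a b = +≤+ (ℤP.∣i+j∣≤∣i∣+∣j∣ a b)

  abs-nonneg : ∀ {a} → 0ℤ ≤ a → abs a ≡ a
  abs-nonneg = ℤP.0≤i⇒+∣i∣≡i

  -- Integer matrices indexed by vertices; power M j is M^(1+j), and its
  -- entries are sums over walks of walk weights (products of entries).
  Matrix : ℕ → Set
  Matrix n = Fin n → Fin n → ℤ

  power : ∀ {n} → Matrix n → ℕ → Matrix n
  power M zero = M
  power M (suc j) a b = Σ (λ x → M a x * power M j x b)

  walkWeight : ∀ {n} → Matrix n → Fin n → List (Fin n) → Fin n → ℤ
  walkWeight M a [] b = M a b
  walkWeight M a (c ∷ cs) b = M a c * walkWeight M c cs b

  pairsWeight : ∀ {n} → Matrix n → List (Fin n × Fin n) → ℤ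
  pairsWeight M [] = 1ℤ
  pairsWeight M ((a , b) ∷ ps) = M a b * pairsWeight M ps

  pairsWeight-zip : ∀ {n} (M : Matrix n) a xs y →
                    pairsWeight M (zip (a ∷ xs) (xs ++ [ y ])) ≡ walkWeight M a xs y
  pairsWeight-zip M a [] y = ℤP.*-identityʳ (M a y)
  pairsWeight-zip M a (c ∷ cs) y = cong (M a c *_) (pairsWeight-zip M c cs y)

  module _ {n : ℕ} (M : Matrix n) where
    sum-walkWeight : ∀ j a b → sumL (tuples n j) (λ xs → walkWeight M a xs b) ≡ power M j a b
    sum-walkWeight zero a b = ℤP.+-identityʳ (M a b)
    sum-walkWeight (suc j) a b = begin
        sumL (concatMap (λ x → map (x ∷_) (tuples n j)) (allFin n)) (λ xs → walkWeight M a xs b)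
      ≡⟨ sum-concatMap (allFin n) (λ x → map (x ∷_) (tuples n j)) _ ⟩
        Σ (λ x → sumL (map (x ∷_) (tuples n j)) (λ xs → walkWeight M a xs b))
      ≡⟨ sum-cong (allFin n) (λ x → trans (sum-map (tuples n j) (x ∷_) _)
            (trans (sum-*ˡ (tuples n j) (M a x) (λ xs → walkWeight M x xs b))
                   (cong (M a x *_) (sum-walkWeight j x b)))) ⟩
        power M (suc j) a b ∎
      where open ≡-Reasoning

    sum-cycleWeight : ∀ j → sumL (tuples n (suc j)) (λ c → pairsWeight M (cyclePairs c))
                            ≡ Σ (λ x → power M j x x)
    sum-cycleWeight j = trans (sum-concatMap (allFin n) (λ x → map (x ∷_) (tuples n j)) _)
      (sum-cong (allFin n) (λ x → trans (sum-map (tuples n j) (x ∷_) _)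
        (trans (sum-cong (tuples n j) (λ xs → pairsWeight-zip M x xs x)) (sum-walkWeight j x x))))

    power-split : ∀ a c x y → power M (a ℕ.+ suc c) x y ≡ Σ (λ z → power M a x z * power M c z y)
    power-split zero c x y = refl
    power-split (suc a) c x y = begin
        Σ (λ w → M x w * power M (a ℕ.+ suc c) w y)
      ≡⟨ sum-cong L (λ w → cong (M x w *_) (power-split a c w y)) ⟩
        Σ (λ w → M x w * Σ (λ z → power M a w z * power M c z y))
      ≡⟨ sum-cong L (λ w → sym (sum-*ˡ L (M x w) _)) ⟩
        Σ (λ w → Σ (λ z → M x w * (power M a w z * power M c z y)))
      ≡⟨ sum-swap L L _ ⟩
        Σ (λ z → Σ (λ w → M x w * (power M a w z * power M c z y)))
      ≡⟨ sum-cong L (λ z → trans (sum-cong L (λ w → sym (ℤP.*-assoc (M x w) _ _)))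
                                 (sum-*ʳ L (power M c z y) (λ w → M x w * power M a w z))) ⟩
        Σ (λ z → power M (suc a) x z * power M c z y) ∎
      where
        open ≡-Reasoning
        L = allFin n

    power-sucʳ : ∀ a x y → power M (suc a) x y ≡ Σ (λ z → power M a x z * M z y)
    power-sucʳ a x y = trans (cong (λ t → power M t x y) (sym (ℕP.+-comm a 1))) (power-split a 0 x y)

  skew : ∀ {n} → Tournament n → Matrix n
  skew T a b = if does (a ≟ b) then 0ℤ else (if adj T a b then 1ℤ else -1ℤ)

  complete : ∀ {n} → Matrix n
  complete a b = if does (a ≟ b) then 0ℤ else 1ℤ

  sign : ℕ → ℤ
  sign zero = 1ℤ
  sign (suc m) = - sign m

  %2-ss : ∀ m → suc (suc m) % 2 ≡ m % 2
  %2-ss m = trans (cong (_% 2) (ℕP.+-comm 2 m)) ([m+n]%n≡m%n m 2)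

  evenIndicator : ∀ m → (if m % 2 ≡ᵇ 0 then + 2 else 0ℤ) ≡ 1ℤ + sign m
  evenIndicator zero = refl
  evenIndicator (suc zero) = refl
  evenIndicator (suc (suc m)) rewrite %2-ss m | ℤP.neg-involutive (sign m) = evenIndicator m

  -- The predicates are abstracted (with their defining equations) so that the
  -- lemma applies to the pattern-matching lambdas used in Defs.
  module _ {n : ℕ} (T : Tournament n) (distinct backwardPair : Fin n × Fin n → Bool)
           (distinct-def : ∀ a b → distinct (a , b) ≡ not (does (a ≟ b)))
           (backward-def : ∀ a b → backwardPair (a , b) ≡ adj T b a) where

    pairsWeight-skew : ∀ ps → pairsWeight (skew T) ps
      ≡ (if allb distinct ps then sign (length (filterᵇ backwardPair ps)) else 0ℤ)
    pairsWeight-skew [] = refl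
    pairsWeight-skew ((a , b) ∷ ps) rewrite distinct-def a b | backward-def a b with a ≟ b
    ... | yes refl = ℤP.*-zeroˡ (pairsWeight (skew T) ps)
    ... | no a≢b rewrite tournament T a b a≢b with adj T a b
    ...   | true = trans (ℤP.*-identityˡ _) (pairsWeight-skew ps)
    ...   | false rewrite pairsWeight-skew ps with allb distinct ps
    ...     | true = ℤP.-1*i≡-i _
    ...     | false = refl

    pairsWeight-complete : ∀ ps → pairsWeight complete ps ≡ (if allb distinct ps then 1ℤ else 0ℤ)
    pairsWeight-complete [] = refl
    pairsWeight-complete ((a , b) ∷ ps) rewrite distinct-def a b with a ≟ b
    ... | yes refl = ℤP.*-zeroˡ (pairsWeight complete ps)
    ... | no a≢b = trans (ℤP.*-identityˡ _) (pairsWeight-complete ps)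

    evenCycleWeight : ∀ ps →
      (if allb distinct ps ∧ (length (filterᵇ backwardPair ps) % 2 ≡ᵇ 0) then + 2 else 0ℤ)
      ≡ pairsWeight complete ps + pairsWeight (skew T) ps
    evenCycleWeight ps rewrite pairsWeight-skew ps | pairsWeight-complete ps with allb distinct ps
    ... | true = evenIndicator (length (filterᵇ backwardPair ps))
    ... | false = refl

  twice-ec : ∀ {n} (T : Tournament n) j →
    + 2 * + ec (suc j) T ≡ Σ {n} (λ x → power complete j x x) + Σ {n} (λ x → power (skew T) j x x)
  twice-ec {n} T j = begin
      + 2 * + ec (suc j) T
    ≡⟨ cong (+ 2 *_) (sum-filter C (isEvenCycle T)) ⟩
      + 2 * sumL C (λ c → if isEvenCycle T c then 1ℤ else 0ℤ)
    ≡⟨ sym (sum-*ˡ C (+ 2) _) ⟩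
      sumL C (λ c → + 2 * (if isEvenCycle T c then 1ℤ else 0ℤ))
    ≡⟨ sum-cong C (λ c → trans (double (isEvenCycle T c))
                               (evenCycleWeight T _ _ (λ _ _ → refl) (λ _ _ → refl) (cyclePairs c))) ⟩
      sumL C (λ c → pairsWeight A (cyclePairs c) + pairsWeight (skew T) (cyclePairs c))
    ≡⟨ sum-+ C _ _ ⟩
      sumL C (λ c → pairsWeight A (cyclePairs c)) + sumL C (λ c → pairsWeight (skew T) (cyclePairs c))
    ≡⟨ cong₂ _+_ (sum-cycleWeight A j) (sum-cycleWeight (skew T) j) ⟩
      Σ {n} (λ x → power complete j x x) + Σ {n} (λ x → power (skew T) j x x) ∎
    where
      open ≡-Reasoning
      C = tuples n (suc j)
      A = complete {n}
      double : ∀ b → + 2 * (if b then 1ℤ else 0ℤ) ≡ (if b then + 2 else 0ℤ)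
      double true = refl
      double false = refl

  -- tr A^k is within 2k n^(k-1) of n^k: entries of A^(1+j) lie between m^j
  -- and n^j when n = 2 + m (a walk avoids at most two forbidden vertices per step).
  kronecker : ∀ {n} → Fin n → Fin n → ℤ
  kronecker a b = if does (a ≟ b) then 1ℤ else 0ℤ

  Σ-kroneckerˡ : ∀ {n} (a : Fin n) → Σ {n} (kronecker a) ≡ 1ℤ
  Σ-kroneckerˡ {suc n} zero = trans (Σ-suc {n} (kronecker zero)) (cong (_+_ 1ℤ) (sum-0 (allFin n)))
  Σ-kroneckerˡ {suc n} (suc a) = trans (Σ-suc {n} (kronecker (suc a))) (trans (ℤP.+-identityˡ _) (Σ-kroneckerˡ a))

  Σ-kroneckerʳ : ∀ {n} (a : Fin n) → Σ {n} (λ x → kronecker x a) ≡ 1ℤ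
  Σ-kroneckerʳ {suc n} zero = trans (Σ-suc {n} (λ x → kronecker x zero)) (cong (_+_ 1ℤ) (sum-0 (allFin n)))
  Σ-kroneckerʳ {suc n} (suc a) = trans (Σ-suc {n} (λ x → kronecker x (suc a))) (trans (ℤP.+-identityˡ _) (Σ-kroneckerʳ a))

  complete+kronecker : ∀ {n} (a x : Fin n) → complete a x + kronecker a x ≡ 1ℤ
  complete+kronecker a x with does (a ≟ x)
  ... | true = refl
  ... | false = refl

  Σ-complete-row : ∀ {n} (a : Fin n) → Σ (complete a) + 1ℤ ≡ + n
  Σ-complete-row {n} a = begin
      Σ (complete a) + 1ℤ
    ≡⟨ cong (_+_ (Σ (complete a))) (sym (Σ-kroneckerˡ a)) ⟩
      Σ (complete a) + Σ (kronecker a)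
    ≡⟨ sym (sum-+ (allFin n) (complete a) (kronecker a)) ⟩
      Σ (λ x → complete a x + kronecker a x)
    ≡⟨ sum-cong (allFin n) (complete+kronecker a) ⟩
      Σ {n} (λ _ → 1ℤ)
    ≡⟨ trans (Σ-const {n} 1ℤ) (ℤP.*-identityʳ (+ n)) ⟩
      + n ∎
    where open ≡-Reasoning

  Σ-complete-row-suc : ∀ {m} (a : Fin (suc m)) → Σ (complete a) ≡ + m
  Σ-complete-row-suc {m} a =
    trans (add-sub (Σ (complete a))) (trans (cong (_- 1ℤ) (Σ-complete-row a)) (ℤP.m-n≡m⊖n (suc m) 1))
    where add-sub : ∀ x → x ≡ x + 1ℤ - 1ℤ
          add-sub = solve-∀

  complete-nonneg : ∀ {n} (a x : Fin n) → 0ℤ ≤ complete a x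
  complete-nonneg a x with does (a ≟ x)
  ... | true = 0≤+
  ... | false = 0≤+

  power-complete-nonneg : ∀ {n} j (a b : Fin n) → 0ℤ ≤ power complete j a b
  power-complete-nonneg zero a b = complete-nonneg a b
  power-complete-nonneg {n} (suc j) a b =
    sum-nonneg (allFin n) (λ x → 0≤* (complete-nonneg a x) (power-complete-nonneg j x b))

  complete-*-≤ : ∀ {n} (a x : Fin n) p → 0ℤ ≤ p → complete a x * p ≤ p
  complete-*-≤ a x p 0≤p with does (a ≟ x)
  ... | true = ℤP.≤-trans (ℤP.≤-reflexive (ℤP.*-zeroˡ p)) 0≤p
  ... | false = ℤP.≤-reflexive (ℤP.*-identityˡ p)

  power-complete-upper : ∀ {n} j (a b : Fin n) → power complete j a b ≤ + (n ^ j)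
  power-complete-upper zero a b with does (a ≟ b)
  ... | true = 0≤+
  ... | false = ℤP.≤-refl
  power-complete-upper {n} (suc j) a b = ℤP.≤-trans
    (sum-mono (allFin n) (λ x → ℤP.≤-trans (complete-*-≤ a x _ (power-complete-nonneg j x b))
                                           (power-complete-upper j x b)))
    (ℤP.≤-reflexive (Σ-const-ℕ {n} (n ^ j)))

  complete²-pointwise : ∀ {n} (a x b : Fin n) → 1ℤ - kronecker a x - kronecker x b ≤ complete a x * complete x b
  complete²-pointwise a x b with does (a ≟ x) | does (x ≟ b)
  ... | true | true = ℤ.-≤+
  ... | true | false = 0≤+
  ... | false | true = 0≤+
  ... | false | false = ℤP.≤-refl

  power-complete-lower₁ : ∀ {m} (a b : Fin (suc (suc m))) → + m ≤ power complete 1 a b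
  power-complete-lower₁ {m} a b =
    ℤP.≤-trans (ℤP.≤-reflexive (sym count)) (sum-mono L (λ x → complete²-pointwise a x b))
    where
      n = suc (suc m)
      L = allFin n
      open ≡-Reasoning
      count : Σ {n} (λ x → 1ℤ - kronecker a x - kronecker x b) ≡ + m
      count = begin
          Σ {n} (λ x → 1ℤ - kronecker a x - kronecker x b)
        ≡⟨ sum-+ L (λ x → 1ℤ - kronecker a x) (λ x → - kronecker x b) ⟩
          Σ {n} (λ x → 1ℤ - kronecker a x) + Σ {n} (λ x → - kronecker x b)
        ≡⟨ cong₂ _+_ (sum-+ L (λ _ → 1ℤ) (λ x → - kronecker a x)) (sum-neg L (λ x → kronecker x b)) ⟩
          Σ {n} (λ _ → 1ℤ) + Σ {n} (λ x → - kronecker a x) - Σ {n} (λ x → kronecker x b)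
        ≡⟨ cong₂ (λ u v → u + v - Σ {n} (λ x → kronecker x b)) (Σ-const {n} 1ℤ) (sum-neg L (kronecker a)) ⟩
          + n * 1ℤ - Σ {n} (kronecker a) - Σ {n} (λ x → kronecker x b)
        ≡⟨ cong₂ (λ u v → + n * 1ℤ - u - v) (Σ-kroneckerˡ a) (Σ-kroneckerʳ b) ⟩
          + n * 1ℤ - 1ℤ - 1ℤ
        ≡⟨ cong (λ z → z * 1ℤ - 1ℤ - 1ℤ) (ℤP.pos-+ 2 m) ⟩
          (+ 2 + + m) * 1ℤ - 1ℤ - 1ℤ
        ≡⟨ simplify (+ m) ⟩
          + m ∎
        where simplify : ∀ x → (+ 2 + x) * 1ℤ - 1ℤ - 1ℤ ≡ x
              simplify = solve-∀

  power-complete-lower : ∀ {m} j (a b : Fin (suc (suc m))) → + (m ^ suc j) ≤ power complete (suc j) a b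
  power-complete-lower {m} zero a b =
    subst (_≤ power complete 1 a b) (cong +_ (sym (ℕP.*-identityʳ m))) (power-complete-lower₁ a b)
  power-complete-lower {m} (suc j) a b = begin
      + (m ℕ.* m ^ suc j)
    ≡⟨ ℤP.pos-* m (m ^ suc j) ⟩
      + m * c
    ≤⟨ *-monoʳ 0≤+ (+≤+ (ℕP.n≤1+n m)) ⟩
      + suc m * c
    ≡⟨ cong (_* c) (sym (Σ-complete-row-suc a)) ⟩
      Σ {n} (complete a) * c
    ≡⟨ sym (sum-*ʳ (allFin n) c (complete a)) ⟩
      Σ {n} (λ x → complete a x * c)
    ≤⟨ sum-mono (allFin n) (λ x → *-monoˡ (complete-nonneg a x) (power-complete-lower j x b)) ⟩
      power complete (suc (suc j)) a b ∎
    where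
      open ℤP.≤-Reasoning
      n = suc (suc m)
      c = + (m ^ suc j)

  traceComplete : ∀ {n} j → ℤ
  traceComplete {n} j = Σ {n} (λ x → power complete j x x)

  traceComplete-upper : ∀ {n} j → traceComplete {n} j ≤ + (n ^ suc j)
  traceComplete-upper {n} j = ℤP.≤-trans (sum-mono (allFin n) (λ x → power-complete-upper j x x))
                                         (ℤP.≤-reflexive (Σ-const-ℕ {n} (n ^ j)))

  traceComplete-lower : ∀ {m} j → + ((2 ℕ.+ m) ℕ.* m ^ suc j) ≤ traceComplete {suc (suc m)} (suc j)
  traceComplete-lower {m} j =
    ℤP.≤-trans (ℤP.≤-reflexive (sym (Σ-const-ℕ {suc (suc m)} (m ^ suc j))))
               (sum-mono (allFin (suc (suc m))) (λ x → power-complete-lower j x x))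

  power-gap : ∀ m j → (2 ℕ.+ m) ^ suc j ℕ.≤ (2 ℕ.+ m) ℕ.* m ^ j ℕ.+ 2 ℕ.* j ℕ.* (2 ℕ.+ m) ^ j
  power-gap m zero = ℕP.≤-reflexive (base m)
    where base : ∀ m → (2 ℕ.+ m) ℕ.* 1 ≡ (2 ℕ.+ m) ℕ.* 1 ℕ.+ 2 ℕ.* 0 ℕ.* 1
          base = ℕSolver.solve-∀
  power-gap m (suc j) = begin
      n ℕ.* n ^ suc j
    ≤⟨ ℕP.*-monoʳ-≤ n (power-gap m j) ⟩
      n ℕ.* (n ℕ.* M ℕ.+ 2 ℕ.* j ℕ.* N)
    ≡⟨ expand m j M N ⟩
      n ℕ.* m ℕ.* M ℕ.+ 2 ℕ.* j ℕ.* (n ℕ.* N) ℕ.+ 2 ℕ.* n ℕ.* M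
    ≤⟨ ℕP.+-monoʳ-≤ (n ℕ.* m ℕ.* M ℕ.+ 2 ℕ.* j ℕ.* (n ℕ.* N))
                    (ℕP.*-monoʳ-≤ (2 ℕ.* n) (ℕP.^-monoˡ-≤ j (ℕP.m≤n+m m 2))) ⟩
      n ℕ.* m ℕ.* M ℕ.+ 2 ℕ.* j ℕ.* (n ℕ.* N) ℕ.+ 2 ℕ.* n ℕ.* N
    ≡⟨ collect m j M N ⟩
      n ℕ.* (m ℕ.* M) ℕ.+ 2 ℕ.* suc j ℕ.* (n ℕ.* N) ∎
    where
      open ℕP.≤-Reasoning
      n = 2 ℕ.+ m
      M = m ^ j
      N = n ^ j
      expand : ∀ m j M N → (2 ℕ.+ m) ℕ.* ((2 ℕ.+ m) ℕ.* M ℕ.+ 2 ℕ.* j ℕ.* N)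
               ≡ (2 ℕ.+ m) ℕ.* m ℕ.* M ℕ.+ 2 ℕ.* j ℕ.* ((2 ℕ.+ m) ℕ.* N) ℕ.+ 2 ℕ.* (2 ℕ.+ m) ℕ.* M
      expand = ℕSolver.solve-∀
      collect : ∀ m j M N → (2 ℕ.+ m) ℕ.* m ℕ.* M ℕ.+ 2 ℕ.* j ℕ.* ((2 ℕ.+ m) ℕ.* N) ℕ.+ 2 ℕ.* (2 ℕ.+ m) ℕ.* N
                ≡ (2 ℕ.+ m) ℕ.* (m ℕ.* M) ℕ.+ 2 ℕ.* (1 ℕ.+ j) ℕ.* ((2 ℕ.+ m) ℕ.* N)
      collect = ℕSolver.solve-∀

  traceComplete-gap : ∀ {m} j →
      0ℤ ≤ + (suc (suc m) ^ suc (suc j)) - traceComplete {suc (suc m)} (suc j)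
    × + (suc (suc m) ^ suc (suc j)) - traceComplete {suc (suc m)} (suc j) ≤ + (2 ℕ.* suc j ℕ.* suc (suc m) ^ suc j)
  traceComplete-gap {m} j = ℤP.i≤j⇒0≤j-i (traceComplete-upper {n} (suc j)) , upper
    where
      n = suc (suc m)
      K = 2 ℕ.* suc j ℕ.* n ^ suc j
      W = traceComplete {n} (suc j)
      N = + (n ^ suc (suc j))
      upper : N - W ≤ + K
      upper = begin
          N - W
        ≤⟨ ℤP.+-monoˡ-≤ (- W) (+≤+ (power-gap m (suc j))) ⟩
          + (n ℕ.* m ^ suc j ℕ.+ K) - W
        ≡⟨ cong (_- W) (ℤP.pos-+ (n ℕ.* m ^ suc j) K) ⟩
          + (n ℕ.* m ^ suc j) + + K - W
        ≤⟨ ℤP.+-monoˡ-≤ (- W) (ℤP.+-monoˡ-≤ (+ K) (traceComplete-lower {m} j)) ⟩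
          W + + K - W
        ≡⟨ cancel W (+ K) ⟩
          + K ∎
        where
          open ℤP.≤-Reasoning
          cancel : ∀ w k → w + k - w ≡ k
          cancel = solve-∀

  module _ {n : ℕ} (T : Tournament n) where
    skew-antisym : ∀ a b → skew T a b ≡ - skew T b a
    skew-antisym a b with a ≟ b | b ≟ a
    ... | yes refl | yes _ = refl
    ... | yes refl | no b≢a = ⊥-elim (b≢a refl)
    ... | no a≢b | yes refl = ⊥-elim (a≢b refl)
    ... | no a≢b | no _ rewrite tournament T a b a≢b with adj T a b
    ...   | true = refl
    ...   | false = refl

    skew-bounded : ∀ a b → abs (skew T a b) ≤ 1ℤ
    skew-bounded a b with does (a ≟ b)
    ... | true = 0≤+
    ... | false with adj T a b
    ...   | true = ℤP.≤-refl
    ...   | false = ℤP.≤-refl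

    power-skew-bounded : ∀ j a b → abs (power (skew T) j a b) ≤ + (n ^ j)
    power-skew-bounded zero a b = skew-bounded a b
    power-skew-bounded (suc j) a b = begin
        abs (Σ {n} (λ x → skew T a x * power (skew T) j x b))
      ≤⟨ sum-abs (allFin n) _ ⟩
        Σ {n} (λ x → abs (skew T a x * power (skew T) j x b))
      ≤⟨ sum-mono (allFin n) entry ⟩
        Σ {n} (λ _ → + (n ^ j))
      ≡⟨ Σ-const-ℕ {n} (n ^ j) ⟩
        + (n ^ suc j) ∎
      where
        open ℤP.≤-Reasoning
        entry : ∀ x → abs (skew T a x * power (skew T) j x b) ≤ + (n ^ j)
        entry x = begin
            abs (skew T a x * power (skew T) j x b)
          ≡⟨ abs-* (skew T a x) _ ⟩
            abs (skew T a x) * abs (power (skew T) j x b)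
          ≤⟨ *-mono 0≤+ 0≤+ (skew-bounded a x) (power-skew-bounded j x b) ⟩
            1ℤ * + (n ^ j)
          ≡⟨ ℤP.*-identityˡ _ ⟩
            + (n ^ j) ∎

  indicator : Bool → ℤ
  indicator b = if b then 1ℤ else 0ℤ

  skewImage : ∀ {n} → Tournament n → Subset n → Fin n → ℤ
  skewImage {n} T Y x = Σ {n} (λ y → skew T x y * indicator (lookup Y y))

  ∣-∣ℕ-via-ℤ : ∀ m n → + ℕ.∣ m - n ∣ ≡ abs (+ m - + n)
  ∣-∣ℕ-via-ℤ m n = cong +_ (sym (trans (cong ∣_∣ (ℤP.m-n≡m⊖n m n)) (⊖-distance m n)))
    where
      ⊖-distance : ∀ m n → ∣ m ⊖ n ∣ ≡ ℕ.∣ m - n ∣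
      ⊖-distance zero zero = refl
      ⊖-distance zero (suc n) = refl
      ⊖-distance (suc m) zero = refl
      ⊖-distance (suc m) (suc n) = trans (cong ∣_∣ (ℤP.[1+m]⊖[1+n]≡m⊖n m n)) (⊖-distance m n)

  module _ {n : ℕ} (T : Tournament n) where
    private
      out-in-pointwise : ∀ (Y : Subset n) v y →
        indicator (lookup Y y ∧ adj T v y) - indicator (lookup Y y ∧ adj T y v)
        ≡ skew T v y * indicator (lookup Y y)
      out-in-pointwise Y v y with v ≟ y
      ... | yes refl rewrite loopless T v with lookup Y v
      ...   | true = refl
      ...   | false = refl
      out-in-pointwise Y v y | no v≢y rewrite tournament T v y v≢y with lookup Y y | adj T v y
      ... | true | true = refl
      ... | true | false = refl
      ... | false | true = refl
      ... | false | false = refl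

    outdeg-indeg : ∀ Y v → + outdeg T v Y - + indeg T v Y ≡ skewImage T Y v
    outdeg-indeg Y v = begin
        + outdeg T v Y - + indeg T v Y
      ≡⟨ cong₂ _-_ (sum-filter L (λ y → lookup Y y ∧ adj T v y)) (sum-filter L (λ y → lookup Y y ∧ adj T y v)) ⟩
        Σ {n} (λ y → indicator (lookup Y y ∧ adj T v y)) - Σ {n} (λ y → indicator (lookup Y y ∧ adj T y v))
      ≡⟨ cong (_+_ (Σ {n} (λ y → indicator (lookup Y y ∧ adj T v y)))) (sym (sum-neg L _)) ⟩
        Σ {n} (λ y → indicator (lookup Y y ∧ adj T v y)) + Σ {n} (λ y → - indicator (lookup Y y ∧ adj T y v))
      ≡⟨ sym (sum-+ L _ _) ⟩
        Σ {n} (λ y → indicator (lookup Y y ∧ adj T v y) - indicator (lookup Y y ∧ adj T y v))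
      ≡⟨ sum-cong L (out-in-pointwise Y v) ⟩
        skewImage T Y v ∎
      where
        open ≡-Reasoning
        L = allFin n

    discrepancy-skew : ∀ X Y →
      + discrepancy T X Y ≡ Σ {n} (λ x → if lookup X x then abs (skewImage T Y x) else 0ℤ)
    discrepancy-skew X Y = trans (sum-ℕ (allFin n) _) (sum-cong (allFin n) term)
      where
        term : ∀ x → + (if lookup X x then ℕ.∣ outdeg T x Y - indeg T x Y ∣ else 0)
                     ≡ (if lookup X x then abs (skewImage T Y x) else 0ℤ)
        term x with lookup X x
        ... | true = trans (∣-∣ℕ-via-ℤ (outdeg T x Y) (indeg T x Y)) (cong abs (outdeg-indeg Y x))
        ... | false = refl

    discrepancy-≤ : ∀ X Y → + discrepancy T X Y ≤ Σ {n} (λ x → abs (skewImage T Y x))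
    discrepancy-≤ X Y = ℤP.≤-trans (ℤP.≤-reflexive (discrepancy-skew X Y)) (sum-mono (allFin n) term)
      where
        term : ∀ x → (if lookup X x then abs (skewImage T Y x) else 0ℤ) ≤ abs (skewImage T Y x)
        term x with lookup X x
        ... | true = ℤP.≤-refl
        ... | false = 0≤+

    discrepancy-all : ∀ Y → + discrepancy T (replicate n true) Y ≡ Σ {n} (λ x → abs (skewImage T Y x))
    discrepancy-all Y = trans (discrepancy-skew (replicate n true) Y)
      (sum-cong (allFin n) (λ x → cong (λ b → if b then abs (skewImage T Y x) else 0ℤ) (lookup-replicate x true)))

  -- Column z of S is 1_{N⁻(z)} - 1_{N⁺(z)}, so (S²)_{xz} is a
  -- difference of two entries of S 1_Y; hence every entry of S³ is bounded by
  -- two discrepancies, and tr S^(4+i) = Σ_{z,w} (S^(1+i))_{zw} (S³)_{wz} is small.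
  module _ {n : ℕ} (T : Tournament n) where
    private
      S : Matrix n
      S = skew T
      L = allFin n

    inNbhd outNbhd : Fin n → Subset n
    inNbhd z = Vec.tabulate (λ y → not (does (y ≟ z)) ∧ adj T y z)
    outNbhd z = Vec.tabulate (λ y → not (does (y ≟ z)) ∧ not (adj T y z))

    skew-column : ∀ y z → S y z ≡ indicator (lookup (inNbhd z) y) - indicator (lookup (outNbhd z) y)
    skew-column y z rewrite lookup∘tabulate (λ y → not (does (y ≟ z)) ∧ adj T y z) y
                          | lookup∘tabulate (λ y → not (does (y ≟ z)) ∧ not (adj T y z)) y
                          with does (y ≟ z)
    ... | true = refl
    ... | false with adj T y z
    ...   | true = refl
    ...   | false = refl

    skew²-entry : ∀ x z → Σ {n} (λ y → S x y * S y z) ≡ skewImage T (inNbhd z) x - skewImage T (outNbhd z) x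
    skew²-entry x z = begin
        Σ {n} (λ y → S x y * S y z)
      ≡⟨ sum-cong L (λ y → trans (cong (S x y *_) (skew-column y z)) (distrib (S x y) _ _)) ⟩
        Σ {n} (λ y → S x y * indicator (lookup (inNbhd z) y) + - (S x y * indicator (lookup (outNbhd z) y)))
      ≡⟨ sum-+ L _ _ ⟩
        skewImage T (inNbhd z) x + Σ {n} (λ y → - (S x y * indicator (lookup (outNbhd z) y)))
      ≡⟨ cong (_+_ (skewImage T (inNbhd z) x)) (sum-neg L _) ⟩
        skewImage T (inNbhd z) x - skewImage T (outNbhd z) x ∎
      where
        open ≡-Reasoning
        distrib : ∀ a b c → a * (b - c) ≡ a * b + - (a * c)
        distrib = solve-∀

    cube : Fin n → Fin n → ℤ
    cube w z = Σ {n} (λ x → S w x * Σ {n} (λ y → S x y * S y z))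

    cube-bounded : ∀ w z → abs (cube w z) ≤
      + discrepancy T (replicate n true) (inNbhd z) + + discrepancy T (replicate n true) (outNbhd z)
    cube-bounded w z = begin
        abs (cube w z)
      ≤⟨ sum-abs L _ ⟩
        Σ {n} (λ x → abs (S w x * Σ {n} (λ y → S x y * S y z)))
      ≤⟨ sum-mono L dropS ⟩
        Σ {n} (λ x → abs (Σ {n} (λ y → S x y * S y z)))
      ≤⟨ sum-mono L (λ x → ℤP.≤-trans (ℤP.≤-reflexive (cong abs (skew²-entry x z)))
                                     (+≤+ (ℤP.∣i-j∣≤∣i∣+∣j∣ (skewImage T (inNbhd z) x) (skewImage T (outNbhd z) x)))) ⟩
        Σ {n} (λ x → abs (skewImage T (inNbhd z) x) + abs (skewImage T (outNbhd z) x))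
      ≡⟨ sum-+ L _ _ ⟩
        Σ {n} (λ x → abs (skewImage T (inNbhd z) x)) + Σ {n} (λ x → abs (skewImage T (outNbhd z) x))
      ≡⟨ cong₂ _+_ (sym (discrepancy-all T (inNbhd z))) (sym (discrepancy-all T (outNbhd z))) ⟩
        + discrepancy T (replicate n true) (inNbhd z) + + discrepancy T (replicate n true) (outNbhd z) ∎
      where
        open ℤP.≤-Reasoning
        dropS : ∀ x → abs (S w x * Σ {n} (λ y → S x y * S y z)) ≤ abs (Σ {n} (λ y → S x y * S y z))
        dropS x = ℤP.≤-trans (ℤP.≤-reflexive (abs-* (S w x) _))
                    (ℤP.≤-trans (*-monoʳ 0≤+ (skew-bounded T w x)) (ℤP.≤-reflexive (ℤP.*-identityˡ _)))

    cube-small : ∀ D → (∀ X Y → D ℕ.* discrepancy T X Y ℕ.≤ n ^ 2) → ∀ w z →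
                 + D * abs (cube w z) ≤ + (2 ℕ.* n ^ 2)
    cube-small D small w z = begin
        + D * abs (cube w z)
      ≤⟨ *-monoˡ {+ D} 0≤+ (cube-bounded w z) ⟩
        + D * (+ discrepancy T V (inNbhd z) + + discrepancy T V (outNbhd z))
      ≡⟨ ℤP.*-distribˡ-+ (+ D) _ _ ⟩
        + D * + discrepancy T V (inNbhd z) + + D * + discrepancy T V (outNbhd z)
      ≡⟨ cong₂ _+_ (sym (ℤP.pos-* D _)) (sym (ℤP.pos-* D _)) ⟩
        + (D ℕ.* discrepancy T V (inNbhd z)) + + (D ℕ.* discrepancy T V (outNbhd z))
      ≤⟨ ℤP.+-mono-≤ (+≤+ (small V (inNbhd z))) (+≤+ (small V (outNbhd z))) ⟩
        + (n ^ 2) + + (n ^ 2)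
      ≡⟨ trans (sym (ℤP.pos-+ (n ^ 2) (n ^ 2))) (cong +_ (cong (n ^ 2 ℕ.+_) (sym (ℕP.+-identityʳ (n ^ 2))))) ⟩
        + (2 ℕ.* n ^ 2) ∎
      where
        open ℤP.≤-Reasoning
        V = replicate n true

  Σ-reorder4 : ∀ {n} (G : Fin n → Fin n → Fin n → Fin n → ℤ) →
    Σ {n} (λ a → Σ {n} (λ b → Σ {n} (λ c → Σ {n} (λ d → G a b c d)))) ≡
    Σ {n} (λ c → Σ {n} (λ d → Σ {n} (λ a → Σ {n} (λ b → G a b c d))))
  Σ-reorder4 {n} G = begin
      Σ {n} (λ a → Σ {n} (λ b → Σ {n} (λ c → Σ {n} (λ d → G a b c d))))
    ≡⟨ sum-cong L (λ a → sum-swap L L (λ b c → Σ {n} (λ d → G a b c d))) ⟩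
      Σ {n} (λ a → Σ {n} (λ c → Σ {n} (λ b → Σ {n} (λ d → G a b c d))))
    ≡⟨ sum-swap L L (λ a c → Σ {n} (λ b → Σ {n} (λ d → G a b c d))) ⟩
      Σ {n} (λ c → Σ {n} (λ a → Σ {n} (λ b → Σ {n} (λ d → G a b c d))))
    ≡⟨ sum-cong L (λ c → sum-cong L (λ a → sum-swap L L (λ b d → G a b c d))) ⟩
      Σ {n} (λ c → Σ {n} (λ a → Σ {n} (λ d → Σ {n} (λ b → G a b c d))))
    ≡⟨ sum-cong L (λ c → sum-swap L L (λ a d → Σ {n} (λ b → G a b c d))) ⟩
      Σ {n} (λ c → Σ {n} (λ d → Σ {n} (λ a → Σ {n} (λ b → G a b c d)))) ∎
    where
      open ≡-Reasoning
      L = allFin n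

  module _ {n : ℕ} (T : Tournament n) where
    private
      S : Matrix n
      S = skew T
      L = allFin n

    trace-via-cube : ∀ i → Σ {n} (λ x → power S (3 ℕ.+ i) x x)
                         ≡ Σ {n} (λ z → Σ {n} (λ w → power S i z w * cube T w z))
    trace-via-cube i = begin
        Σ {n} (λ x → power S (3 ℕ.+ i) x x)
      ≡⟨ sum-cong L (λ x → sum-cong L (λ y → expandLeft x y)) ⟩
        Σ {n} (λ x → Σ {n} (λ y → Σ {n} (λ z → Σ {n} (λ w → F x y z w))))
      ≡⟨ Σ-reorder4 F ⟩
        Σ {n} (λ z → Σ {n} (λ w → Σ {n} (λ x → Σ {n} (λ y → F x y z w))))
      ≡⟨ sym (sum-cong L (λ z → sum-cong L (λ w → expandRight z w))) ⟩
        Σ {n} (λ z → Σ {n} (λ w → R z w * cube T w z)) ∎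
      where
        open ≡-Reasoning
        R = power S i
        F : Fin n → Fin n → Fin n → Fin n → ℤ
        F x y z w = S x y * (S y z * (R z w * S w x))
        rotate : ∀ r a b c → r * (a * (b * c)) ≡ b * (c * (r * a))
        rotate = solve-∀
        expandLeft : ∀ x y → S x y * power S (2 ℕ.+ i) y x ≡ Σ {n} (λ z → Σ {n} (λ w → F x y z w))
        expandLeft x y =
          trans (cong (S x y *_) (sum-cong L (λ z → trans (cong (S y z *_) (power-sucʳ S i z x)) (Σ-*ˡ {n} (S y z) _))))
                (trans (Σ-*ˡ {n} (S x y) _) (sum-cong L (λ z → Σ-*ˡ {n} (S x y) _)))
        expandRight : ∀ z w → R z w * cube T w z ≡ Σ {n} (λ x → Σ {n} (λ y → F x y z w))
        expandRight z w = trans (Σ-*ˡ {n} (R z w) _) (sum-cong L (λ x →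
          trans (cong (R z w *_) (Σ-*ˡ {n} (S w x) _))
                (trans (Σ-*ˡ {n} (R z w) _) (sum-cong L (λ y → rotate (R z w) (S w x) (S x y) (S y z))))))

    trace-small : ∀ D i → (∀ X Y → D ℕ.* discrepancy T X Y ℕ.≤ n ^ 2) →
                  + D * abs (Σ {n} (λ x → power S (3 ℕ.+ i) x x)) ≤ + (n ℕ.* (n ℕ.* (n ^ i ℕ.* (2 ℕ.* n ^ 2))))
    trace-small D i small = begin
        + D * abs (Σ {n} (λ x → power S (3 ℕ.+ i) x x))
      ≡⟨ cong (λ q → + D * abs q) (trace-via-cube i) ⟩
        + D * abs (Σ {n} (λ z → Σ {n} (λ w → power S i z w * cube T w z)))
      ≤⟨ *-monoˡ {+ D} 0≤+ (ℤP.≤-trans (sum-abs L _) (sum-mono L (λ z → ℤP.≤-trans (sum-abs L _)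
            (sum-mono L (λ w → ℤP.≤-reflexive (abs-* (power S i z w) (cube T w z))))))) ⟩
        + D * Σ {n} (λ z → Σ {n} (λ w → abs (power S i z w) * abs (cube T w z)))
      ≡⟨ trans (Σ-*ˡ {n} (+ D) _) (sum-cong L (λ z → trans (Σ-*ˡ {n} (+ D) _)
           (sum-cong L (λ w → swap (+ D) (abs (power S i z w)) (abs (cube T w z)))))) ⟩
        Σ {n} (λ z → Σ {n} (λ w → abs (power S i z w) * (+ D * abs (cube T w z))))
      ≤⟨ sum-mono L (λ z → sum-mono L (λ w → *-mono 0≤+ (0≤* {+ D} 0≤+ 0≤+)
           (power-skew-bounded T i z w) (cube-small T D small w z))) ⟩
        Σ {n} (λ z → Σ {n} (λ w → + (n ^ i) * + (2 ℕ.* n ^ 2)))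
      ≡⟨ trans (sum-cong L (λ z → trans (sum-cong L (λ w → sym (ℤP.pos-* (n ^ i) _))) (Σ-const-ℕ {n} _)))
               (Σ-const-ℕ {n} _) ⟩
        + (n ℕ.* (n ℕ.* (n ^ i ℕ.* (2 ℕ.* n ^ 2)))) ∎
      where
        open ℤP.≤-Reasoning
        swap : ∀ d a b → d * (a * b) ≡ a * (d * b)
        swap = solve-∀

  -- Part (ii).  Cauchy–Schwarz over ℤ, via the one-step inequality
  -- (fg + A)² ≤ (f² + B)(g² + C) whenever A² ≤ BC and B, C ≥ 0.
  ≤-from-squares : ∀ {X Y} → 0ℤ ≤ X → Y * Y ≤ X * X → Y ≤ X
  ≤-from-squares {+ x} {ℤ.-[1+ y ]} _ _ = ℤ.-≤+
  ≤-from-squares {+ x} {+ y} _ h =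
    +≤+ (ℕP.≮⇒≥ (λ x<y → ℕP.<⇒≱ (ℕP.*-mono-< x<y x<y) (ℤP.drop‿+≤+ h')))
    where h' : + (y ℕ.* y) ≤ + (x ℕ.* x)
          h' = subst₂ _≤_ (sym (ℤP.pos-* y y)) (sym (ℤP.pos-* x x)) h

  cauchySchwarz-step : ∀ f g A B C → 0ℤ ≤ B → 0ℤ ≤ C → A * A ≤ B * C →
                       (f * g + A) * (f * g + A) ≤ (f * f + B) * (g * g + C)
  cauchySchwarz-step f g A B C 0≤B 0≤C A²≤BC = ≤-by-difference slack 0≤slack expand
    where
      -- the cross term 2fgA is dominated by f²C + B g² (AM–GM)
      X = f * f * C + B * (g * g)
      Y = + 2 * f * g * A
      0≤X : 0ℤ ≤ X
      0≤X = subst (_≤ X) (ℤP.+-identityʳ 0ℤ) (ℤP.+-mono-≤ (0≤* (0≤square f) 0≤C) (0≤* 0≤B (0≤square g)))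
      Y²≤X² : Y * Y ≤ X * X
      Y²≤X² = ℤP.≤-trans (ℤP.≤-reflexive (Y² f g A)) (ℤP.≤-trans
                (*-monoˡ {+ 4 * (f * f) * (g * g)} (0≤* (0≤* {+ 4} 0≤+ (0≤square f)) (0≤square g)) A²≤BC)
                (≤-by-difference (Z * Z) (0≤square Z) (X² f g B C)))
        where
          Z = f * f * C - B * (g * g)
          Y² : ∀ f g A → (+ 2 * f * g * A) * (+ 2 * f * g * A) ≡ (+ 4 * (f * f) * (g * g)) * (A * A)
          Y² = solve-∀
          X² : ∀ f g B C → (f * f * C + B * (g * g)) * (f * f * C + B * (g * g)) ≡
                 (+ 4 * (f * f) * (g * g)) * (B * C) + (f * f * C - B * (g * g)) * (f * f * C - B * (g * g))
          X² = solve-∀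
      slack = (X - Y) + (B * C - A * A)
      0≤slack : 0ℤ ≤ slack
      0≤slack = subst (_≤ slack) (ℤP.+-identityʳ 0ℤ)
                  (ℤP.+-mono-≤ (ℤP.i≤j⇒0≤j-i (≤-from-squares 0≤X Y²≤X²)) (ℤP.i≤j⇒0≤j-i A²≤BC))
      expand : (f * f + B) * (g * g + C) ≡ (f * g + A) * (f * g + A) + slack
      expand = identity f g A B C
        where
          identity : ∀ f g A B C → (f * f + B) * (g * g + C) ≡ (f * g + A) * (f * g + A) +
                       ((f * f * C + B * (g * g) - + 2 * f * g * A) + (B * C - A * A))
          identity = solve-∀

  cauchySchwarz : {A : Set} (L : List A) (f g : A → ℤ) →
    sumL L (λ x → f x * g x) * sumL L (λ x → f x * g x) ≤ sumL L (λ x → f x * f x) * sumL L (λ x → g x * g x)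
  cauchySchwarz [] f g = ℤP.≤-refl
  cauchySchwarz (x ∷ L) f g = cauchySchwarz-step (f x) (g x) _ _ _
    (sum-nonneg L (λ y → 0≤square (f y))) (sum-nonneg L (λ y → 0≤square (g y))) (cauchySchwarz L f g)

  module LogConvex (a : ℕ → ℤ) (nonneg : ∀ j → 0ℤ ≤ a j)
                   (logConvex : ∀ j → a (suc j) * a (suc j) ≤ a j * a (suc (suc j))) where

    -- a_1 a_(1+j) ≤ a_0 a_(2+j), by induction dividing through by a_(2+j) > 0.
    cross : ∀ j → a 1 * a (suc j) ≤ a 0 * a (suc (suc j))
    cross zero = logConvex 0
    cross (suc j) with a (suc (suc j)) in eq
    ... | + zero = ℤP.≤-trans (ℤP.≤-reflexive (ℤP.*-zeroʳ (a 1))) (0≤* (nonneg 0) (nonneg (3 ℕ.+ j)))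
    ... | ℤ.+[1+ q ] = ℤP.*-cancelʳ-≤-pos (a 1 * c) (a 0 * a (3 ℕ.+ j)) c (begin
          a 1 * c * c
        ≡⟨ ℤP.*-assoc (a 1) c c ⟩
          a 1 * (c * c)
        ≤⟨ *-monoˡ (nonneg 1) (subst (λ t → t * t ≤ a (suc j) * a (3 ℕ.+ j)) eq (logConvex (suc j))) ⟩
          a 1 * (a (suc j) * a (3 ℕ.+ j))
        ≡⟨ sym (ℤP.*-assoc (a 1) _ _) ⟩
          a 1 * a (suc j) * a (3 ℕ.+ j)
        ≤⟨ *-monoʳ (nonneg (3 ℕ.+ j)) (subst (λ t → a 1 * a (suc j) ≤ a 0 * t) eq (cross j)) ⟩
          a 0 * c * a (3 ℕ.+ j)
        ≡⟨ exchange (a 0) c (a (3 ℕ.+ j)) ⟩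
          a 0 * a (3 ℕ.+ j) * c ∎)
      where
        open ℤP.≤-Reasoning
        c = ℤ.+[1+ q ]
        exchange : ∀ x y z → x * y * z ≡ x * z * y
        exchange = solve-∀
    ... | ℤ.-[1+ q ] with subst (0ℤ ≤_) eq (nonneg (suc (suc j)))
    ...   | ()

    power-bound : ∀ j → a 1 ^ᶻ suc j ≤ a 0 ^ᶻ j * a (suc j)
    power-bound zero = ℤP.≤-reflexive (trans (ℤP.*-identityʳ (a 1)) (sym (ℤP.*-identityˡ (a 1))))
    power-bound (suc j) = begin
        a 1 * a 1 ^ᶻ suc j
      ≤⟨ *-monoˡ (nonneg 1) (power-bound j) ⟩
        a 1 * (a 0 ^ᶻ j * a (suc j))
      ≡⟨ exchange (a 1) (a 0 ^ᶻ j) (a (suc j)) ⟩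
        a 0 ^ᶻ j * (a 1 * a (suc j))
      ≤⟨ *-monoˡ (0≤^ j (nonneg 0)) (cross j) ⟩
        a 0 ^ᶻ j * (a 0 * a (suc (suc j)))
      ≡⟨ sym (ℤP.*-assoc (a 0 ^ᶻ j) (a 0) _) ⟩
        a 0 ^ᶻ j * a 0 * a (suc (suc j))
      ≡⟨ cong (_* a (suc (suc j))) (ℤP.*-comm (a 0 ^ᶻ j) (a 0)) ⟩
        a 0 * a 0 ^ᶻ j * a (suc (suc j)) ∎
      where
        open ℤP.≤-Reasoning
        exchange : ∀ x y z → x * (y * z) ≡ y * (x * z)
        exchange = solve-∀

  ^ᶻ-distrib-* : ∀ x y m → (x * y) ^ᶻ m ≡ x ^ᶻ m * y ^ᶻ m
  ^ᶻ-distrib-* x y zero = refl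
  ^ᶻ-distrib-* x y (suc m) rewrite ^ᶻ-distrib-* x y m = exchange x y (x ^ᶻ m) (y ^ᶻ m)
    where exchange : ∀ x y p q → x * y * (p * q) ≡ x * p * (y * q)
          exchange = solve-∀

  pos-^ : ∀ a m → + (a ^ m) ≡ (+ a) ^ᶻ m
  pos-^ a zero = refl
  pos-^ a (suc m) = trans (ℤP.pos-* a (a ^ m)) (cong (+ a *_) (pos-^ a m))

  ^ᶻ-monoˡ : ∀ {x y} m → 0ℤ ≤ x → x ≤ y → x ^ᶻ m ≤ y ^ᶻ m
  ^ᶻ-monoˡ zero _ _ = ℤP.≤-refl
  ^ᶻ-monoˡ (suc m) 0≤x x≤y = *-mono 0≤x (0≤^ m 0≤x) x≤y (^ᶻ-monoˡ m 0≤x x≤y)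

  abs-sign : ∀ m → abs (sign m) ≡ 1ℤ
  abs-sign zero = refl
  abs-sign (suc m) = trans (cong +_ (ℤP.∣-i∣≡∣i∣ (sign m))) (abs-sign m)

  abs-square : ∀ a → abs a * abs a ≡ a * a
  abs-square a = trans (sym (abs-* a a)) (abs-nonneg (0≤square a))

  -- Vectors acted on by S.  Skewness gives ⟨S u, w⟩ = -⟨u, S w⟩, so with
  -- a_j = ‖S^j y‖² Cauchy–Schwarz yields a_(j+1)² = ⟨S^j y, S^(j+2) y⟩² ≤ a_j a_(j+2).
  module SkewVectors {n : ℕ} (T : Tournament n) where
    private
      S : Matrix n
      S = skew T
      L = allFin n

    apply : (Fin n → ℤ) → Fin n → ℤ
    apply u x = Σ {n} (λ z → S x z * u z)

    dot : (Fin n → ℤ) → (Fin n → ℤ) → ℤ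
    dot u w = Σ {n} (λ x → u x * w x)

    dot-apply : ∀ u w → dot (apply u) w ≡ - dot u (apply w)
    dot-apply u w = begin
        Σ {n} (λ x → Σ {n} (λ z → S x z * u z) * w x)
      ≡⟨ sum-cong L (λ x → sym (sum-*ʳ L (w x) _)) ⟩
        Σ {n} (λ x → Σ {n} (λ z → S x z * u z * w x))
      ≡⟨ sum-swap L L _ ⟩
        Σ {n} (λ z → Σ {n} (λ x → S x z * u z * w x))
      ≡⟨ sum-cong L (λ z → sum-cong L (λ x → trans (cong (λ t → t * u z * w x) (skew-antisym T x z))
                                                   (rearrange (S z x) (u z) (w x)))) ⟩
        Σ {n} (λ z → Σ {n} (λ x → - (u z * (S z x * w x))))
      ≡⟨ sum-cong L (λ z → trans (sum-neg L _) (cong -_ (sym (Σ-*ˡ {n} (u z) _)))) ⟩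
        Σ {n} (λ z → - (u z * apply w z))
      ≡⟨ sum-neg L _ ⟩
        - dot u (apply w) ∎
      where
        open ≡-Reasoning
        rearrange : ∀ s a b → - s * a * b ≡ - (a * (s * b))
        rearrange = solve-∀

    iterate : (Fin n → ℤ) → ℕ → Fin n → ℤ
    iterate y zero = y
    iterate y (suc j) = apply (iterate y j)

    normSq : (Fin n → ℤ) → ℕ → ℤ
    normSq y j = dot (iterate y j) (iterate y j)

    normSq-nonneg : ∀ y j → 0ℤ ≤ normSq y j
    normSq-nonneg y j = sum-nonneg L (λ x → 0≤square (iterate y j x))

    normSq-logConvex : ∀ y j → normSq y (suc j) * normSq y (suc j) ≤ normSq y j * normSq y (suc (suc j))
    normSq-logConvex y j = ℤP.≤-trans
      (ℤP.≤-reflexive (trans (cong (λ t → t * t) (dot-apply (iterate y j) (iterate y (suc j))))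
                             (neg-square (dot (iterate y j) (iterate y (suc (suc j)))))))
      (cauchySchwarz L (iterate y j) (iterate y (suc (suc j))))
      where neg-square : ∀ p → - p * - p ≡ p * p
            neg-square = solve-∀

    iterate-power : ∀ y j x → iterate y (suc j) x ≡ Σ {n} (λ z → power S j x z * y z)
    iterate-power y zero x = refl
    iterate-power y (suc j) x = begin
        Σ {n} (λ w → S x w * iterate y (suc j) w)
      ≡⟨ sum-cong L (λ w → trans (cong (S x w *_) (iterate-power y j w)) (Σ-*ˡ {n} (S x w) _)) ⟩
        Σ {n} (λ w → Σ {n} (λ z → S x w * (power S j w z * y z)))
      ≡⟨ sum-swap L L _ ⟩
        Σ {n} (λ z → Σ {n} (λ w → S x w * (power S j w z * y z)))
      ≡⟨ sum-cong L (λ z → trans (sum-cong L (λ w → sym (ℤP.*-assoc (S x w) _ _)))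
                                 (sum-*ʳ L (y z) (λ w → S x w * power S j w z))) ⟩
        Σ {n} (λ z → power S (suc j) x z * y z) ∎
      where open ≡-Reasoning

    frobenius : ℕ → ℤ
    frobenius j = Σ {n} (λ x → Σ {n} (λ z → power S j x z * power S j x z))

    frobenius-nonneg : ∀ j → 0ℤ ≤ frobenius j
    frobenius-nonneg j = sum-nonneg L (λ x → sum-nonneg L (λ z → 0≤square (power S j x z)))

    normSq-≤-frobenius : ∀ y j → normSq y (suc j) ≤ frobenius j * normSq y 0
    normSq-≤-frobenius y j = begin
        Σ {n} (λ x → iterate y (suc j) x * iterate y (suc j) x)
      ≡⟨ sum-cong L (λ x → cong (λ t → t * t) (iterate-power y j x)) ⟩
        Σ {n} (λ x → Σ {n} (λ z → power S j x z * y z) * Σ {n} (λ z → power S j x z * y z))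
      ≤⟨ sum-mono L (λ x → cauchySchwarz L (power S j x) y) ⟩
        Σ {n} (λ x → Σ {n} (λ z → power S j x z * power S j x z) * normSq y 0)
      ≡⟨ sum-*ʳ L (normSq y 0) _ ⟩
        frobenius j * normSq y 0 ∎
      where open ℤP.≤-Reasoning

    power-transpose : ∀ j z x → power S j z x ≡ sign (suc j) * power S j x z
    power-transpose zero z x = trans (skew-antisym T z x) (sym (ℤP.-1*i≡-i (S x z)))
    power-transpose (suc j) z x = begin
        Σ {n} (λ w → S z w * power S j w x)
      ≡⟨ sum-cong L (λ w → trans (cong₂ _*_ (skew-antisym T z w) (power-transpose j w x))
                                 (rearrange (S w z) (sign (suc j)) (power S j x w))) ⟩
        Σ {n} (λ w → - sign (suc j) * (power S j x w * S w z))
      ≡⟨ sym (Σ-*ˡ {n} (- sign (suc j)) _) ⟩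
        - sign (suc j) * Σ {n} (λ w → power S j x w * S w z)
      ≡⟨ cong (- sign (suc j) *_) (sym (power-sucʳ S j x z)) ⟩
        sign (suc (suc j)) * power S (suc j) x z ∎
      where
        open ≡-Reasoning
        rearrange : ∀ s g p → - s * (g * p) ≡ - g * (p * s)
        rearrange = solve-∀

    abs-trace-even : ∀ j → abs (Σ {n} (λ x → power S (j ℕ.+ suc j) x x)) ≡ frobenius j
    abs-trace-even j = begin
        abs (Σ {n} (λ x → power S (j ℕ.+ suc j) x x))
      ≡⟨ cong abs trace≡ ⟩
        abs (sign (suc j) * frobenius j)
      ≡⟨ abs-* (sign (suc j)) (frobenius j) ⟩
        abs (sign (suc j)) * abs (frobenius j)
      ≡⟨ cong₂ _*_ (abs-sign (suc j)) (abs-nonneg (frobenius-nonneg j)) ⟩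
        1ℤ * frobenius j
      ≡⟨ ℤP.*-identityˡ _ ⟩
        frobenius j ∎
      where
        open ≡-Reasoning
        commute : ∀ p s → p * (s * p) ≡ s * (p * p)
        commute = solve-∀
        trace≡ : Σ {n} (λ x → power S (j ℕ.+ suc j) x x) ≡ sign (suc j) * frobenius j
        trace≡ = trans (sum-cong L (λ x → trans (power-split S j j x x)
                   (trans (sum-cong L (λ z → trans (cong (power S j x z *_) (power-transpose j z x))
                                                   (commute (power S j x z) (sign (suc j)))))
                          (sym (Σ-*ˡ {n} (sign (suc j)) _)))))
                   (sym (Σ-*ˡ {n} (sign (suc j)) _))

    module _ (Y : Subset n) where
      private
        y : Fin n → ℤ
        y z = indicator (lookup Y z)

      discrepancy-squared : ∀ X → + discrepancy T X Y * + discrepancy T X Y ≤ + n * normSq y 1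
      discrepancy-squared X = begin
          + discrepancy T X Y * + discrepancy T X Y
        ≤⟨ *-mono 0≤+ 0≤+ (discrepancy-≤ T X Y) (discrepancy-≤ T X Y) ⟩
          D * D
        ≡⟨ sym (cong₂ _*_ one* one*) ⟩
          Σ {n} (λ x → 1ℤ * abs (apply y x)) * Σ {n} (λ x → 1ℤ * abs (apply y x))
        ≤⟨ cauchySchwarz L (λ _ → 1ℤ) (λ x → abs (apply y x)) ⟩
          Σ {n} (λ _ → 1ℤ * 1ℤ) * Σ {n} (λ x → abs (apply y x) * abs (apply y x))
        ≡⟨ cong₂ _*_ (trans (Σ-const {n} 1ℤ) (ℤP.*-identityʳ (+ n))) (sum-cong L (λ x → abs-square (apply y x))) ⟩
          + n * normSq y 1 ∎
        where
          open ℤP.≤-Reasoning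
          D = Σ {n} (λ x → abs (apply y x))
          one* = sum-cong L (λ x → ℤP.*-identityˡ (abs (apply y x)))

      normSq-indicator : normSq y 0 ≤ + n
      normSq-indicator = ℤP.≤-trans (sum-mono L (λ z → atMostOne (lookup Y z)))
                                    (ℤP.≤-reflexive (trans (Σ-const {n} 1ℤ) (ℤP.*-identityʳ (+ n))))
        where atMostOne : ∀ b → indicator b * indicator b ≤ 1ℤ
              atMostOne true = ℤP.≤-refl
              atMostOne false = 0≤+

      discrepancy-power : ∀ X m → (+ discrepancy T X Y * + discrepancy T X Y) ^ᶻ suc m
                                  ≤ (+ n * + n) ^ᶻ suc m * frobenius m
      discrepancy-power X m = begin
          (d * d) ^ᶻ suc m
        ≤⟨ ^ᶻ-monoˡ (suc m) (0≤square d) (discrepancy-squared X) ⟩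
          (+ n * a 1) ^ᶻ suc m
        ≡⟨ ^ᶻ-distrib-* (+ n) (a 1) (suc m) ⟩
          (+ n) ^ᶻ suc m * a 1 ^ᶻ suc m
        ≤⟨ *-monoˡ (nPow (suc m)) (LogConvex.power-bound a (normSq-nonneg y) (normSq-logConvex y) m) ⟩
          (+ n) ^ᶻ suc m * (a 0 ^ᶻ m * a (suc m))
        ≤⟨ *-monoˡ (nPow (suc m)) (*-monoˡ (0≤^ m (normSq-nonneg y 0)) (normSq-≤-frobenius y m)) ⟩
          (+ n) ^ᶻ suc m * (a 0 ^ᶻ m * (frobenius m * a 0))
        ≡⟨ cong ((+ n) ^ᶻ suc m *_) (regroup (a 0 ^ᶻ m) (frobenius m) (a 0)) ⟩
          (+ n) ^ᶻ suc m * (a 0 ^ᶻ suc m * frobenius m)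
        ≤⟨ *-monoˡ (nPow (suc m)) (*-monoʳ (frobenius-nonneg m)
                                           (^ᶻ-monoˡ (suc m) (normSq-nonneg y 0) normSq-indicator)) ⟩
          (+ n) ^ᶻ suc m * ((+ n) ^ᶻ suc m * frobenius m)
        ≡⟨ sym (ℤP.*-assoc ((+ n) ^ᶻ suc m) _ _) ⟩
          (+ n) ^ᶻ suc m * (+ n) ^ᶻ suc m * frobenius m
        ≡⟨ cong (_* frobenius m) (sym (^ᶻ-distrib-* (+ n) (+ n) (suc m))) ⟩
          (+ n * + n) ^ᶻ suc m * frobenius m ∎
        where
          open ℤP.≤-Reasoning
          d = + discrepancy T X Y
          a = normSq y
          nPow : ∀ k → 0ℤ ≤ (+ n) ^ᶻ k
          nPow k = 0≤^ k 0≤+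
          regroup : ∀ p f q → p * (f * q) ≡ q * p * f
          regroup = solve-∀

  discrepancy-via-trace : ∀ {n} (T : Tournament n) m X Y →
    (+ discrepancy T X Y * + discrepancy T X Y) ^ᶻ suc m
      ≤ (+ n * + n) ^ᶻ suc m * abs (Σ {n} (λ x → power (skew T) (m ℕ.+ suc m) x x))
  discrepancy-via-trace {n} T m X Y =
    subst (λ t → (+ discrepancy T X Y * + discrepancy T X Y) ^ᶻ suc m ≤ (+ n * + n) ^ᶻ suc m * t)
          (sym (SkewVectors.abs-trace-even T m))
          (SkewVectors.discrepancy-power T Y X m)

  module Cycles {m : ℕ} (T : Tournament (suc (suc m))) (j : ℕ) where
    n k : ℕ
    n = suc (suc m)
    k = suc (suc j)

    N W t deviation : ℤ
    N = + (n ^ k)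
    W = traceComplete {n} (suc j)
    t = Σ {n} (λ x → power (skew T) (suc j) x x)
    deviation = + 2 * + ec k T - N

    deviation≡ : deviation ≡ t - (N - W)
    deviation≡ = trans (cong (_- N) (twice-ec T (suc j))) (regroup W t N)
      where regroup : ∀ w t N → w + t - N ≡ t - (N - w)
            regroup = solve-∀

    0≤N-W : 0ℤ ≤ N - W
    0≤N-W = proj₁ (traceComplete-gap {m} j)

    deviation-≤ : abs deviation ≤ (N - W) + abs t
    deviation-≤ = begin
        abs deviation
      ≡⟨ cong abs (trans deviation≡ (ℤP.+-comm t (- (N - W)))) ⟩
        abs (- (N - W) + t)
      ≤⟨ abs-+ (- (N - W)) t ⟩
        abs (- (N - W)) + abs t
      ≡⟨ cong (_+ abs t) (trans (cong +_ (ℤP.∣-i∣≡∣i∣ (N - W))) (abs-nonneg 0≤N-W)) ⟩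
        (N - W) + abs t ∎
      where open ℤP.≤-Reasoning

    trace-≤ : abs t ≤ abs deviation + (N - W)
    trace-≤ = begin
        abs t
      ≡⟨ cong abs (trans (regroup t (N - W)) (cong (_+ (N - W)) (sym deviation≡))) ⟩
        abs (deviation + (N - W))
      ≤⟨ abs-+ deviation (N - W) ⟩
        abs deviation + abs (N - W)
      ≡⟨ cong (_+_ (abs deviation)) (abs-nonneg 0≤N-W) ⟩
        abs deviation + (N - W) ∎
      where
        open ℤP.≤-Reasoning
        regroup : ∀ a b → a ≡ (a - b) + b
        regroup = solve-∀

    gap-scaled : ∀ c → 0ℤ ≤ c → c * + (2 ℕ.* suc j) ≤ + n → c * (N - W) ≤ N
    gap-scaled c 0≤c large = begin
        c * (N - W)
      ≤⟨ *-monoˡ 0≤c (proj₂ (traceComplete-gap {m} j)) ⟩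
        c * + (2 ℕ.* suc j ℕ.* n ^ suc j)
      ≡⟨ cong (c *_) (ℤP.pos-* (2 ℕ.* suc j) (n ^ suc j)) ⟩
        c * (+ (2 ℕ.* suc j) * + (n ^ suc j))
      ≡⟨ sym (ℤP.*-assoc c _ _) ⟩
        c * + (2 ℕ.* suc j) * + (n ^ suc j)
      ≤⟨ *-monoʳ 0≤+ large ⟩
        + n * + (n ^ suc j)
      ≡⟨ sym (ℤP.pos-* n (n ^ suc j)) ⟩
        N ∎
      where open ℤP.≤-Reasoning

    deviation-small : ∀ c → 0ℤ ≤ c → c * + (2 ℕ.* suc j) ≤ + n → c * abs t ≤ N →
                      c * abs deviation ≤ + 2 * N
    deviation-small c 0≤c large small = begin
        c * abs deviation
      ≤⟨ *-monoˡ 0≤c deviation-≤ ⟩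
        c * ((N - W) + abs t)
      ≡⟨ ℤP.*-distribˡ-+ c (N - W) (abs t) ⟩
        c * (N - W) + c * abs t
      ≤⟨ ℤP.+-mono-≤ (gap-scaled c 0≤c large) small ⟩
        N + N
      ≡⟨ double N ⟩
        + 2 * N ∎
      where
        open ℤP.≤-Reasoning
        double : ∀ x → x + x ≡ + 2 * x
        double = solve-∀

    trace-small-from-deviation : ∀ c → 0ℤ ≤ c → + 2 * c * + (2 ℕ.* suc j) ≤ + n →
                                 + 2 * c * abs deviation ≤ N → c * abs t ≤ N
    trace-small-from-deviation c 0≤c large small = ℤP.*-cancelˡ-≤-pos (c * abs t) N (+ 2) (begin
        + 2 * (c * abs t)
      ≤⟨ *-monoˡ {+ 2} 0≤+ (*-monoˡ 0≤c trace-≤) ⟩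
        + 2 * (c * (abs deviation + (N - W)))
      ≡⟨ distrib c (abs deviation) (N - W) ⟩
        + 2 * c * abs deviation + + 2 * c * (N - W)
      ≤⟨ ℤP.+-mono-≤ small (gap-scaled (+ 2 * c) (0≤* {+ 2} 0≤+ 0≤c) large) ⟩
        N + N
      ≡⟨ double N ⟩
        + 2 * N ∎)
      where
        open ℤP.≤-Reasoning
        distrib : ∀ c a b → + 2 * (c * (a + b)) ≡ + 2 * c * a + + 2 * c * b
        distrib = solve-∀
        double : ∀ x → x + x ≡ + 2 * x
        double = solve-∀

  Q⇒P : ∀ {m} (T : Tournament (suc (suc m))) i E →
        2 ℕ.* (4 ℕ.+ i) ℕ.* E ℕ.≤ suc (suc m) →
        (∀ X Y → discrepancy T X Y ℕ.* (2 ℕ.* E) ℕ.≤ suc (suc m) ^ 2) →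
        abs (Cycles.deviation T (2 ℕ.+ i)) * + E ≤ Cycles.N T (2 ℕ.+ i) * + 2
  Q⇒P {m} T i E large small =
    subst₂ _≤_ (ℤP.*-comm (+ E) _) (ℤP.*-comm (+ 2) N) (deviation-small (+ E) 0≤+ large′ traceBound)
    where
      open Cycles T (2 ℕ.+ i)
      large′ : + E * + (2 ℕ.* (3 ℕ.+ i)) ≤ + n
      large′ = subst (_≤ + n) (ℤP.pos-* E (2 ℕ.* (3 ℕ.+ i))) (+≤+ (ℕP.≤-trans
        (ℕP.≤-reflexive (ℕP.*-comm E (2 ℕ.* (3 ℕ.+ i))))
        (ℕP.≤-trans (ℕP.*-monoˡ-≤ E (ℕP.*-monoʳ-≤ 2 (ℕP.n≤1+n (3 ℕ.+ i)))) large)))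
      N≡ : n ℕ.* (n ℕ.* (n ^ i ℕ.* (2 ℕ.* n ^ 2))) ≡ 2 ℕ.* n ^ (4 ℕ.+ i)
      N≡ = reorder n (n ^ i)
        where reorder : ∀ n p → n ℕ.* (n ℕ.* (p ℕ.* (2 ℕ.* (n ℕ.* (n ℕ.* 1)))))
                                ≡ 2 ℕ.* (n ℕ.* (n ℕ.* (n ℕ.* (n ℕ.* p))))
              reorder = ℕSolver.solve-∀
      traceBound : + E * abs t ≤ N
      traceBound = ℤP.*-cancelˡ-≤-pos (+ E * abs t) N (+ 2) (begin
          + 2 * (+ E * abs t)
        ≡⟨ trans (sym (ℤP.*-assoc (+ 2) (+ E) (abs t))) (cong (_* abs t) (sym (ℤP.pos-* 2 E))) ⟩
          + (2 ℕ.* E) * abs t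
        ≤⟨ trace-small T (2 ℕ.* E) i (λ X Y → subst (ℕ._≤ n ^ 2) (ℕP.*-comm (discrepancy T X Y) _) (small X Y)) ⟩
          + (n ℕ.* (n ℕ.* (n ^ i ℕ.* (2 ℕ.* n ^ 2))))
        ≡⟨ trans (cong +_ N≡) (ℤP.pos-* 2 (n ^ (4 ℕ.+ i))) ⟩
          + 2 * N ∎)
        where open ℤP.≤-Reasoning

  ^-cancelˡ : ∀ a b m → (+ a) ^ᶻ suc m ≤ (+ b) ^ᶻ suc m → a ℕ.≤ b
  ^-cancelˡ a b m h = ℕP.≮⇒≥ (λ b<a → ℕP.<⇒≱ (ℕP.^-monoˡ-< (suc m) b<a) (ℤP.drop‿+≤+ h′))
    where h′ : + (a ^ suc m) ≤ + (b ^ suc m)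
          h′ = subst₂ _≤_ (sym (pos-^ a (suc m))) (sym (pos-^ b (suc m))) h

  square-cancel : ∀ a b → a ℕ.* a ℕ.≤ b ℕ.* b → a ℕ.≤ b
  square-cancel a b h = ℕP.≮⇒≥ (λ b<a → ℕP.<⇒≱ (ℕP.*-mono-< b<a b<a) h)

  ^ᶻ-double : ∀ x m → x ^ᶻ suc (suc (m ℕ.+ m)) ≡ (x * x) ^ᶻ suc m
  ^ᶻ-double x zero = trans (cong (x *_) (ℤP.*-identityʳ x)) (sym (ℤP.*-identityʳ (x * x)))
  ^ᶻ-double x (suc m) rewrite ℕP.+-suc m m = trans (sym (ℤP.*-assoc x x _)) (cong ((x * x) *_) (^ᶻ-double x m))

  discrepancy-from-trace : ∀ {n} (T : Tournament n) m E →
    (+ E * + E) ^ᶻ suc m * abs (Σ {n} (λ x → power (skew T) (suc (m ℕ.+ m)) x x)) ≤ + (n ^ suc (suc (m ℕ.+ m))) →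
    ∀ X Y → discrepancy T X Y ℕ.* E ℕ.≤ n ^ 2
  discrepancy-from-trace {n} T m E traceSmall X Y =
    subst (discrepancy T X Y ℕ.* E ℕ.≤_) (cong (n ℕ.*_) (sym (ℕP.*-identityʳ n)))
      (square-cancel (discrepancy T X Y ℕ.* E) (n ℕ.* n)
        (^-cancelˡ _ _ m (subst₂ (λ u v → u ^ᶻ suc m ≤ v ^ᶻ suc m) (square-ℕ Ed) (square-ℕ nn≡) roots)))
    where
      c = (+ E * + E) ^ᶻ suc m
      t = Σ {n} (λ x → power (skew T) (suc (m ℕ.+ m)) x x)
      d = + discrepancy T X Y
      nn = + n * + n
      N≡ : + (n ^ suc (suc (m ℕ.+ m))) ≡ nn ^ᶻ suc m
      N≡ = trans (pos-^ n (suc (suc (m ℕ.+ m)))) (^ᶻ-double (+ n) m)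
      discrepancy-trace : (d * d) ^ᶻ suc m ≤ nn ^ᶻ suc m * abs t
      discrepancy-trace = subst (λ s → (d * d) ^ᶻ suc m ≤ nn ^ᶻ suc m * abs (Σ {n} (λ x → power (skew T) s x x)))
                                (ℕP.+-suc m m) (discrepancy-via-trace T m X Y)
      roots : ((+ E * d) * (+ E * d)) ^ᶻ suc m ≤ (nn * nn) ^ᶻ suc m
      roots = begin
          ((+ E * d) * (+ E * d)) ^ᶻ suc m
        ≡⟨ cong (_^ᶻ suc m) (interchange (+ E) d) ⟩
          ((+ E * + E) * (d * d)) ^ᶻ suc m
        ≡⟨ ^ᶻ-distrib-* (+ E * + E) (d * d) (suc m) ⟩
          c * (d * d) ^ᶻ suc m
        ≤⟨ *-monoˡ (0≤^ (suc m) (0≤square (+ E))) discrepancy-trace ⟩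
          c * (nn ^ᶻ suc m * abs t)
        ≡⟨ exchange c (nn ^ᶻ suc m) (abs t) ⟩
          nn ^ᶻ suc m * (c * abs t)
        ≤⟨ *-monoˡ (0≤^ (suc m) (0≤square (+ n))) traceSmall ⟩
          nn ^ᶻ suc m * + (n ^ suc (suc (m ℕ.+ m)))
        ≡⟨ cong (nn ^ᶻ suc m *_) N≡ ⟩
          nn ^ᶻ suc m * nn ^ᶻ suc m
        ≡⟨ sym (^ᶻ-distrib-* nn nn (suc m)) ⟩
          (nn * nn) ^ᶻ suc m ∎
        where
          open ℤP.≤-Reasoning
          interchange : ∀ e d → (e * d) * (e * d) ≡ (e * e) * (d * d)
          interchange = solve-∀
          exchange : ∀ z p t → z * (p * t) ≡ p * (z * t)
          exchange = solve-∀
      Ed : + E * d ≡ + (discrepancy T X Y ℕ.* E)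
      Ed = trans (ℤP.*-comm (+ E) d) (sym (ℤP.pos-* (discrepancy T X Y) E))
      nn≡ : nn ≡ + (n ℕ.* n)
      nn≡ = sym (ℤP.pos-* n n)
      square-ℕ : ∀ {x a} → x ≡ + a → x * x ≡ + (a ℕ.* a)
      square-ℕ {a = a} refl = sym (ℤP.pos-* a a)

  P⇒Q : ∀ {m} (T : Tournament (suc (suc m))) m' E →
        suc (suc (m' ℕ.+ m')) ℕ.* (4 ℕ.* (E ℕ.* E) ^ suc m') ℕ.≤ suc (suc m) →
        abs (Cycles.deviation T (m' ℕ.+ m')) * + (4 ℕ.* (E ℕ.* E) ^ suc m') ≤ Cycles.N T (m' ℕ.+ m') * + 2 →
        ∀ X Y → discrepancy T X Y ℕ.* E ℕ.≤ suc (suc m) ^ 2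
  P⇒Q {m} T m' E large close =
    discrepancy-from-trace T m' E (trace-small-from-deviation c (subst (0ℤ ≤_) C≡c 0≤+) large′ deviationSmall)
    where
      open Cycles T (m' ℕ.+ m')
      C = (E ℕ.* E) ^ suc m'
      c = (+ E * + E) ^ᶻ suc m'
      C≡c : + C ≡ c
      C≡c = trans (pos-^ (E ℕ.* E) (suc m')) (cong (_^ᶻ suc m') (ℤP.pos-* E E))
      large′ : + 2 * c * + (2 ℕ.* suc (m' ℕ.+ m')) ≤ + n
      large′ = subst (_≤ + n) (trans (ℤP.pos-* (2 ℕ.* C) _)
                                     (cong (_* + (2 ℕ.* suc (m' ℕ.+ m'))) (trans (ℤP.pos-* 2 C) (cong (+ 2 *_) C≡c))))
        (+≤+ (ℕP.≤-trans (ℕP.≤-reflexive (reorder C (m' ℕ.+ m')))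
                         (ℕP.≤-trans (ℕP.*-monoˡ-≤ (4 ℕ.* C) (ℕP.n≤1+n (suc (m' ℕ.+ m')))) large)))
        where reorder : ∀ C j → 2 ℕ.* C ℕ.* (2 ℕ.* suc j) ≡ suc j ℕ.* (4 ℕ.* C)
              reorder = ℕSolver.solve-∀
      deviationSmall : + 2 * c * abs deviation ≤ N
      deviationSmall = ℤP.*-cancelˡ-≤-pos _ N (+ 2) (subst₂ _≤_
        (trans (cong (abs deviation *_) (trans (ℤP.pos-* 4 C) (cong (+ 4 *_) C≡c))) (reorder (abs deviation) c))
        (ℤP.*-comm N (+ 2)) close)
        where reorder : ∀ a c → a * (+ 4 * c) ≡ + 2 * (+ 2 * c * a)
              reorder = solve-∀

-- Translation between the rational inequalities of the statement and the
-- integer inequalities of Core: all rationals involved are computed through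
-- their unnormalised representatives.
module Rationals where

  open Core using (abs)
  open import Data.Nat as ℕ using (ℕ; suc)
  import Data.Nat.Properties as ℕP
  open import Data.Integer as ℤ using (ℤ; +_; 1ℤ; _+_; _*_; -_; _-_; _≤_; +≤+)
  import Data.Integer.Properties as ℤP
  open import Data.Integer.Tactic.RingSolver using (solve-∀)
  open import Data.Rational as ℚ using (ℚ; mkℚ; Positive; ½; toℚᵘ)
  import Data.Rational.Properties as ℚP
  open import Data.Rational.Unnormalised as ℚᵘ using (mkℚᵘ; *≤*; *≡*) renaming (_≃_ to _≃ᵘ_; _≤_ to _≤ᵘ_)
  import Data.Rational.Unnormalised.Properties as ℚᵘP
  open import Data.Nat.Coprimality using (1-coprimeTo)
  open import Relation.Binary.PropositionalEquality

  -- 1 / (1 + d)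
  unitFraction : ℕ → ℚ
  unitFraction d = mkℚ (+ 1) d (1-coprimeTo (suc d))

  ℕtoℚᵘ : ∀ a → toℚᵘ (ℕtoℚ a) ≃ᵘ mkℚᵘ (+ a) 0
  ℕtoℚᵘ a = ℚP.toℚᵘ-fromℚᵘ (mkℚᵘ (+ a) 0)

  scaleᵘ : ∀ q b → toℚᵘ (q ℚ.* ℕtoℚ b) ≃ᵘ mkℚᵘ (ℚ.numerator q * + b) (ℚ.denominator-1 q)
  scaleᵘ q@(mkℚ z d _) b = ℚᵘP.≃-trans (ℚP.toℚᵘ-homo-* q (ℕtoℚ b))
    (ℚᵘP.≃-trans (ℚᵘP.*-cong (ℚᵘP.≃-refl {mkℚᵘ z d}) (ℕtoℚᵘ b))
                 (*≡* (cong (λ t → (z * + b) * + suc t) (sym (ℕP.*-identityʳ d)))))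

  deviationᵘ : ∀ c N → toℚᵘ (ℕtoℚ c ℚ.- ½ ℚ.* ℕtoℚ N) ≃ᵘ mkℚᵘ (+ 2 * + c - + N) 1
  deviationᵘ c N = ℚᵘP.≃-trans (ℚP.toℚᵘ-homo-+ (ℕtoℚ c) (ℚ.- (½ ℚ.* ℕtoℚ N)))
    (ℚᵘP.≃-trans (ℚᵘP.+-cong (ℕtoℚᵘ c) (ℚᵘP.≃-trans (ℚP.toℚᵘ-homo‿- (½ ℚ.* ℕtoℚ N))
                   (ℚᵘP.-‿cong (ℚᵘP.≃-trans (ℚP.toℚᵘ-homo-* ½ (ℕtoℚ N))
                                            (ℚᵘP.*-cong (ℚᵘP.≃-refl {mkℚᵘ 1ℤ 1}) (ℕtoℚᵘ N))))))
      (*≡* (cross (+ c) (+ N))))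
    where cross : ∀ x y → (x * + 2 + - (1ℤ * y) * + 1) * + 2 ≡ (+ 2 * x - y) * + 2
          cross = solve-∀

  abs-deviationᵘ : ∀ c N → toℚᵘ (ℚ.∣ ℕtoℚ c ℚ.- ½ ℚ.* ℕtoℚ N ∣) ≃ᵘ mkℚᵘ (abs (+ 2 * + c - + N)) 1
  abs-deviationᵘ c N = subst (_≃ᵘ mkℚᵘ (abs (+ 2 * + c - + N)) 1) (sym (toℚᵘ-abs (ℕtoℚ c ℚ.- ½ ℚ.* ℕtoℚ N)))
                             (ℚᵘP.∣-∣-cong (deviationᵘ c N))
    where toℚᵘ-abs : ∀ x → toℚᵘ (ℚ.∣ x ∣) ≡ ℚᵘ.∣ toℚᵘ x ∣
          toℚᵘ-abs (mkℚ _ _ _) = refl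

  ≤-unitFraction : ∀ d {D} → suc d ≡ D → ∀ a b → ℕtoℚ a ℚ.≤ unitFraction d ℚ.* ℕtoℚ b → a ℕ.* D ℕ.≤ b
  ≤-unitFraction d refl a b h = ℤP.drop‿+≤+ (subst₂ _≤_ (sym (ℤP.pos-* a (suc d)))
                                                  (trans (ℤP.*-identityʳ _) (ℤP.*-identityˡ (+ b)))
                                                  (ℚᵘP.drop-*≤* h′))
    where
      h′ : mkℚᵘ (+ a) 0 ≤ᵘ mkℚᵘ (1ℤ * + b) d
      h′ = ℚᵘP.≤-respʳ-≃ (scaleᵘ (unitFraction d) b) (ℚᵘP.≤-respˡ-≃ (ℕtoℚᵘ a) (ℚP.toℚᵘ-mono-≤ h))

  ≤-scaled : ∀ q → Positive q → ∀ a b → a ℕ.* suc (ℚ.denominator-1 q) ℕ.≤ b →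
             ℕtoℚ a ℚ.≤ q ℚ.* ℕtoℚ b
  ≤-scaled q@(mkℚ ℤ.+[1+ p ] d _) _ a b h =
    ℚP.toℚᵘ-cancel-≤ (ℚᵘP.≤-respʳ-≃ (ℚᵘP.≃-sym (scaleᵘ q b))
                                   (ℚᵘP.≤-respˡ-≃ (ℚᵘP.≃-sym (ℕtoℚᵘ a)) (*≤* le)))
    where
      le : + a * + suc d ≤ (ℤ.+[1+ p ] * + b) * + 1
      le = subst₂ _≤_ (ℤP.pos-* a (suc d)) (trans (ℤP.pos-* (suc p) b) (sym (ℤP.*-identityʳ _)))
             (+≤+ (ℕP.≤-trans h (ℕP.m≤n*m b (suc p))))

  deviation-unitFraction : ∀ d {D} → suc d ≡ D → ∀ c N →
                           ℚ.∣ ℕtoℚ c ℚ.- ½ ℚ.* ℕtoℚ N ∣ ℚ.≤ unitFraction d ℚ.* ℕtoℚ N →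
                           abs (+ 2 * + c - + N) * + D ≤ + N * + 2
  deviation-unitFraction d refl c N h =
    subst (λ t → abs (+ 2 * + c - + N) * + suc d ≤ t * + 2) (ℤP.*-identityˡ (+ N)) (ℚᵘP.drop-*≤* h′)
    where
      h′ : mkℚᵘ (abs (+ 2 * + c - + N)) 1 ≤ᵘ mkℚᵘ (1ℤ * + N) d
      h′ = ℚᵘP.≤-respʳ-≃ (scaleᵘ (unitFraction d) N) (ℚᵘP.≤-respˡ-≃ (abs-deviationᵘ c N) (ℚP.toℚᵘ-mono-≤ h))

  deviation-scaled : ∀ q → Positive q → ∀ c N →
                     abs (+ 2 * + c - + N) * + suc (ℚ.denominator-1 q) ≤ + N * + 2 →
                     ℚ.∣ ℕtoℚ c ℚ.- ½ ℚ.* ℕtoℚ N ∣ ℚ.≤ q ℚ.* ℕtoℚ N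
  deviation-scaled q@(mkℚ ℤ.+[1+ p ] d _) _ c N h =
    ℚP.toℚᵘ-cancel-≤ (ℚᵘP.≤-respʳ-≃ (ℚᵘP.≃-sym (scaleᵘ q N))
                                   (ℚᵘP.≤-respˡ-≃ (ℚᵘP.≃-sym (abs-deviationᵘ c N)) (*≤* le)))
    where
      le : abs (+ 2 * + c - + N) * + suc d ≤ (ℤ.+[1+ p ] * + N) * + 2
      le = ℤP.≤-trans h (ℤP.*-monoʳ-≤-nonNeg (+ 2) (subst (_≤ ℤ.+[1+ p ] * + N) (ℤP.*-identityˡ (+ N))
             (ℤP.*-monoʳ-≤-nonNeg (+ N) {1ℤ} {ℤ.+[1+ p ]} (+≤+ (ℕ.s≤s ℕ.z≤n)))))

open import Data.Nat as ℕ using (ℕ; zero; suc; _≤_; _^_; _%_)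
import Data.Nat.Properties as ℕP
open import Data.Nat.Divisibility using (divides; m%n≡0⇒n∣m)
open import Data.Rational as ℚ using (ℚ; Positive; _*_; _-_; ∣_∣; ½) renaming (_≤_ to _≤ℚ_)
open import Data.Product using (_×_; _,_; proj₁; proj₂; ∃-syntax)
open import Relation.Binary.PropositionalEquality using (_≡_; refl; sym; trans; cong; subst)
open Core using (Q⇒P; P⇒Q)
open Rationals

Quasirandom : ∀ {n} → ℚ → Tournament n → Set
Quasirandom {n} δ T = (X Y : Subset n) → ℕtoℚ (discrepancy T X Y) ≤ℚ δ * ℕtoℚ (n ^ 2)

CycleBalanced : ∀ {n} → ℕ → ℚ → Tournament n → Set
CycleBalanced {n} k δ T = ∣ ℕtoℚ (ec k T) - ½ * ℕtoℚ (n ^ k) ∣ ≤ℚ δ * ℕtoℚ (n ^ k)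

Implies : (∀ {n} → ℚ → Tournament n → Set) → (∀ {n} → ℚ → Tournament n → Set) → Set
Implies P Q = (ε : ℚ) → Positive ε → ∃[ δ ] (Positive δ × ∃[ n₀ ] ((n : ℕ) → n₀ ≤ n → (T : Tournament n) →
              P δ T → Q ε T))

quasirandom⇒balanced : ∀ i → Implies Quasirandom (CycleBalanced (4 ℕ.+ i))
quasirandom⇒balanced i ε ε>0 = unitFraction d , _ , 2 ℕ.+ 2 ℕ.* (4 ℕ.+ i) ℕ.* E , large⇒
  where
    E = suc (ℚ.denominator-1 ε)
    d = ℚ.denominator-1 ε ℕ.+ E
    suc-d : suc d ≡ 2 ℕ.* E
    suc-d = cong (λ x → E ℕ.+ x) (sym (ℕP.+-identityʳ E))
    large⇒ : (n : ℕ) → 2 ℕ.+ 2 ℕ.* (4 ℕ.+ i) ℕ.* E ≤ n → (T : Tournament n) →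
             Quasirandom (unitFraction d) T → CycleBalanced (4 ℕ.+ i) ε T
    large⇒ (suc zero) (ℕ.s≤s ())
    large⇒ (suc (suc m)) large T quasi = deviation-scaled ε ε>0 (ec (4 ℕ.+ i) T) (suc (suc m) ^ (4 ℕ.+ i))
      (Q⇒P T i E (ℕP.≤-trans (ℕP.m≤n+m _ 2) large)
         (λ X Y → ≤-unitFraction d suc-d (discrepancy T X Y) (suc (suc m) ^ 2) (quasi X Y)))

balanced⇒quasirandom : ∀ m' → Implies (CycleBalanced (suc (suc (m' ℕ.+ m')))) Quasirandom
balanced⇒quasirandom m' ε ε>0 = unitFraction d , _ , 2 ℕ.+ k ℕ.* (4 ℕ.* C) , large⇒
  where
    k = suc (suc (m' ℕ.+ m'))
    E = suc (ℚ.denominator-1 ε)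
    C = (E ℕ.* E) ^ suc m'
    d = 4 ℕ.* C ℕ.∸ 1
    suc-d : suc d ≡ 4 ℕ.* C
    suc-d = ℕP.m+[n∸m]≡n (ℕP.≤-trans (ℕP.m^n>0 (E ℕ.* E) (suc m')) (ℕP.m≤n*m C 4))
    large⇒ : (n : ℕ) → 2 ℕ.+ k ℕ.* (4 ℕ.* C) ≤ n → (T : Tournament n) →
             CycleBalanced k (unitFraction d) T → Quasirandom ε T
    large⇒ (suc zero) (ℕ.s≤s ())
    large⇒ (suc (suc m)) large T balanced X Y = ≤-scaled ε ε>0 (discrepancy T X Y) (n ^ 2)
      (P⇒Q T m' E (ℕP.≤-trans (ℕP.m≤n+m _ 2) large)
         (deviation-unitFraction d suc-d (ec k T) (n ^ k) balanced) X Y)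
      where n = suc (suc m)

even-form : ∀ k → k % 2 ≡ 0 → 4 ≤ k → ∃[ m' ] (suc (suc (m' ℕ.+ m')) ≡ k)
even-form k even 4≤k with m%n≡0⇒n∣m k 2 even
... | divides (suc m') refl =
  m' , cong (λ x → suc (suc x)) (trans (cong (m' ℕ.+_) (sym (ℕP.+-identityʳ m'))) (ℕP.*-comm 2 m'))
... | divides zero refl with 4≤k
...   | ()

theorem1p1 : (k : ℕ) → k % 2 ≡ 0 → 4 ≤ k →
  ((ε : ℚ) → Positive ε → ∃[ δ ] (Positive δ × ∃[ n₀ ] ((n : ℕ) → n₀ ≤ n → (T : Tournament n) →
      ((X Y : Subset n) → ℕtoℚ (discrepancy T X Y) ≤ℚ δ * ℕtoℚ (n ^ 2)) →
      ∣ ℕtoℚ (ec k T) - ½ * ℕtoℚ (n ^ k) ∣ ≤ℚ ε * ℕtoℚ (n ^ k))))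
  ×
  ((ε : ℚ) → Positive ε → ∃[ δ ] (Positive δ × ∃[ n₀ ] ((n : ℕ) → n₀ ≤ n → (T : Tournament n) →
      ∣ ℕtoℚ (ec k T) - ½ * ℕtoℚ (n ^ k) ∣ ≤ℚ δ * ℕtoℚ (n ^ k) →
      (X Y : Subset n) → ℕtoℚ (discrepancy T X Y) ≤ℚ ε * ℕtoℚ (n ^ 2))))
theorem1p1 k even 4≤k =
  subst (λ k → Implies Quasirandom (CycleBalanced k)) (ℕP.m+[n∸m]≡n 4≤k) (quasirandom⇒balanced (k ℕ.∸ 4)) ,
  subst (λ k → Implies (CycleBalanced k) Quasirandom) (proj₂ half) (balanced⇒quasirandom (proj₁ half))
  where half = even-form k even 4≤k
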